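{- For all integers $k\in\mathbb{Z}$ and all integers $j\geq 1$, $$D_{k+j}= \big[D_{k},\,(p_j[\mathbf{x}/M])^\bullet\big],\qquad D_{k-j}= (-1)^j\, \big[p_j^\perp,\,D_{k}\big],$$ where $[A,B]=AB-BA$.
   Context: $\Lambda$ denotes the algebra of symmetric functions in infinitely many variables $\mathbf{x}=x_1,x_2,\ldots$ over $\mathbb{Q}(q,t)$, with Hall scalar product (for which Schur functions are orthonormal). For $f\in\Lambda$, $f^\bullet$ is the operator of multiplication by $f$, and $f^\perp$ is its adjoint for the Hall scalar product. $p_j$ is the $j$-th power sum. Set $M=(1-q)(1-t)$. Plethystic notation: $f[A]$ is obtained by writing $f$ in power sums and replacing $p_k$ by $p_k[A]$, where $p_k$ is additive, multiplicative, $p_k[A/B]=p_k[A]/p_k[B]$, $p_k[x]=x^k$ for variables $x$ (including $q,t,x_i$), so $p_j[\mathbf{x}/M]=p_j(\mathbf{x})/((1-q^j)(1-t^j))$; in particular for $f\in\Lambda$, $f[\mathbf{x}+M/z]$ is $f$ with $p_k$ replaced by $p_k(\mathbf{x})+(1-q^k)(1-t^k)z^{ -k}$. The operators $D_k$, $k\in\mathbb{Z}$, on $\Lambda$ are defined by the formal series identity in $z$ $$\sum_{k=-\infty}^{\infty} D_k\, z^k\,(f(\mathbf{x})) = \mathbb{H}[-z\mathbf{x}]\; f[\mathbf{x}+M/z],\qquad f\in\Lambda,$$ (i.e. $\sum_k D_k z^k=\mathbb{H}[-z\mathbf{x}]^\bullet\,\mathbb{H}[\mathbf{x}M/z]^\perp$),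 where $\mathbb{H}[-z\mathbf{x}]=\exp\big(\sum_{i\geq 1} p_i(\mathbf{x})(-z)^i/i\big)$. -}

module Defs where

open import Data.Nat as ℕ using (ℕ; zero; suc; _∸_)
open import Data.Nat using (_!)
open import Data.Integer as ℤ using (ℤ; +_; -[1+_])
open import Data.Rational as ℚ using (ℚ; 0ℚ; 1ℚ)
open import Data.List using (List; []; _∷_; _++_; map; concatMap; replicate; foldr; upTo; length)
open import Data.Product using (_×_; _,_)
open import Data.Bool using (Bool; true; false; _∧_; if_then_else_)
open import Relation.Binary.PropositionalEquality using (_≡_)
open import Relation.Nullary using (¬_)

fromℕQ : ℕ → ℚ
fromℕQ n = (+ n) ℚ./ 1

-- 1/n for n ≥ 1 (only used for n ≥ 1)
recipℕ : ℕ → ℚ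
recipℕ zero    = 0ℚ
recipℕ (suc n) = (+ 1) ℚ./ (suc n)

signQ : ℕ → ℚ
signQ zero    = 1ℚ
signQ (suc n) = ℚ.- signQ n

-- Polynomials in q, t, p₁, p₂, … over ℚ  (i.e. ℚ[q,t][p₁,p₂,…])
-- A monomial q^qe t^te ∏ p_{i+1}^{pe[i]}; lists of exponents are
-- compared up to trailing zeros.

record Mono : Set where
  constructor mono
  field
    qe : ℕ
    te : ℕ
    pe : List ℕ   -- position i (0-based) = exponent of p_{i+1}
open Mono public

Poly : Set
Poly = List (ℚ × Mono)

expEq : List ℕ → List ℕ → Bool
expEq []       []       = true
expEq []       (y ∷ ys) = (y ℕ.≡ᵇ 0) ∧ expEq [] ys
expEq (x ∷ xs) []       = (x ℕ.≡ᵇ 0) ∧ expEq xs []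
expEq (x ∷ xs) (y ∷ ys) = (x ℕ.≡ᵇ y) ∧ expEq xs ys

monoEq : Mono → Mono → Bool
monoEq (mono a b α) (mono c d β) = (a ℕ.≡ᵇ c) ∧ ((b ℕ.≡ᵇ d) ∧ expEq α β)

coeff : Poly → Mono → ℚ
coeff []             m = 0ℚ
coeff ((c , m') ∷ f) m = (if monoEq m' m then c else 0ℚ) ℚ.+ coeff f m

_≈P_ : Poly → Poly → Set
f ≈P g = ∀ m → coeff f m ≡ coeff g m

addExp : List ℕ → List ℕ → List ℕ
addExp []       ys       = ys
addExp (x ∷ xs) []       = x ∷ xs
addExp (x ∷ xs) (y ∷ ys) = (x ℕ.+ y) ∷ addExp xs ys

monoMul : Mono → Mono → Mono
monoMul (mono a b α) (mono c d β) = mono (a ℕ.+ c) (b ℕ.+ d) (addExp α β)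

_+P_ : Poly → Poly → Poly
f +P g = f ++ g

scaleP : ℚ → Poly → Poly
scaleP s = map (λ { (c , m) → (s ℚ.* c , m) })

_-P_ : Poly → Poly → Poly
f -P g = f +P scaleP (ℚ.- 1ℚ) g

_*P_ : Poly → Poly → Poly
f *P g = concatMap (λ { (c , m) → map (λ { (c' , m') → (c ℚ.* c' , monoMul m m') }) g }) f

sumP : List Poly → Poly
sumP = foldr _+P_ []

constP : ℚ → Poly
constP c = (c , mono 0 0 []) ∷ []

-- the power sum p_j (for j ≥ 1; p 0 is never used)
p : ℕ → Poly
p zero    = []
p (suc i) = (1ℚ , mono 0 0 (replicate i 0 ++ (1 ∷ []))) ∷ []

-- Polynomials in q, t only (ℚ[q,t]), used as denominators

QT : Set
QT = List (ℚ × ℕ × ℕ)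

emb : QT → Poly
emb = map (λ { (c , a , b) → (c , mono a b []) })

_*QT_ : QT → QT → QT
f *QT g = concatMap (λ { (c , a , b) → map (λ { (c' , a' , b') → (c ℚ.* c' , a ℕ.+ a' , b ℕ.+ b') }) g }) f

Mj : ℕ → QT
Mj j = ((1ℚ , 0 , 0) ∷ (ℚ.- 1ℚ , j , 0) ∷ []) *QT ((1ℚ , 0 , 0) ∷ (ℚ.- 1ℚ , 0 , j) ∷ [])

NonZeroQT : QT → Set
NonZeroQT d = ¬ (emb d ≈P [])

-- Λ = symmetric functions over ℚ(q,t) = ℚ(q,t)[p₁,p₂,…], represented as
-- fractions  num / den  with num ∈ ℚ[q,t][p₁,…], den ∈ ℚ[q,t] (den ≠ 0,
-- imposed as a hypothesis where needed).

record Λ : Set where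
  constructor _/Λ_
  field
    num : Poly
    den : QT
open Λ public

_≈Λ_ : Λ → Λ → Set
(f /Λ d) ≈Λ (g /Λ e) = (f *P emb e) ≈P (g *P emb d)

_+Λ_ : Λ → Λ → Λ
(f /Λ d) +Λ (g /Λ e) = ((f *P emb e) +P (g *P emb d)) /Λ (d *QT e)

scaleΛ : ℚ → Λ → Λ
scaleΛ s (f /Λ d) = scaleP s f /Λ d

_-Λ_ : Λ → Λ → Λ
F -Λ G = F +Λ scaleΛ (ℚ.- 1ℚ) G

pMul : ℕ → Λ → Λ
pMul j (f /Λ d) = (p j *P f) /Λ d

-- multiplication operator  (p_j[x/M])^• ,  p_j[x/M] = p_j / ((1-q^j)(1-t^j))
pxMMul : ℕ → Λ → Λ
pxMMul j (f /Λ d) = (p j *P f) /Λ (d *QT Mj j)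

record K : Set where
  constructor _/K_
  field
    knum : QT
    kden : QT

_≈K_ : K → K → Set
(a /K d) ≈K (b /K e) = emb (a *QT e) ≈P emb (b *QT d)

-- Hall scalar product: ⟨p_λ, p_μ⟩ = z_λ δ_{λμ}, ℚ(q,t)-bilinear.

-- z_α = ∏_i i^{α_i} α_i!   (α_i = multiplicity of part i)
zee : List ℕ → ℚ
zee α = go 1 α
  where
  go : ℕ → List ℕ → ℚ
  go i []       = 1ℚ
  go i (a ∷ as) = fromℕQ ((i ℕ.^ a) ℕ.* (a !)) ℚ.* go (suc i) as

hallP : Poly → Poly → QT
hallP f g = concatMap (λ { (c , mono a b α) →
              concatMap (λ { (c' , mono a' b' β) →
                 if expEq α β then (c ℚ.* c' ℚ.* zee α , a ℕ.+ a' , b ℕ.+ b') ∷ [] else [] }) g }) f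

hall : Λ → Λ → K
hall (f /Λ d) (g /Λ e) = hallP f g /K (d *QT e)

-- Laurent polynomials in w = 1/z with coefficients in Poly
-- (index n of the list = coefficient of z^{-n})
LPoly : Set
LPoly = List Poly

addL : LPoly → LPoly → LPoly
addL []       ys       = ys
addL (x ∷ xs) []       = x ∷ xs
addL (x ∷ xs) (y ∷ ys) = (x +P y) ∷ addL xs ys

scaleLP : Poly → LPoly → LPoly
scaleLP c = map (c *P_)

mulL : LPoly → LPoly → LPoly
mulL []       ys = []
mulL (x ∷ xs) ys = addL (scaleLP x ys) ([] ∷ mulL xs ys)

powL : LPoly → ℕ → LPoly
powL b zero    = constP 1ℚ ∷ []
powL b (suc n) = mulL b (powL b n)

-- p_{i+1}[x + M/z] = p_{i+1} + (1-q^{i+1})(1-t^{i+1}) z^{-(i+1)}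
pShift : ℕ → LPoly
pShift i = p (suc i) ∷ (replicate i [] ++ (emb (Mj (suc i)) ∷ []))

plethMono : ℕ → List ℕ → LPoly
plethMono i []       = constP 1ℚ ∷ []
plethMono i (a ∷ as) = mulL (powL (pShift i) a) (plethMono (suc i) as)

-- f ↦ f[x + M/z]
pleth : Poly → LPoly
pleth []                       = []
pleth ((c , mono a b α) ∷ f) =
  addL (scaleLP ((c , mono a b []) ∷ []) (plethMono 0 α)) (pleth f)

lookupL : LPoly → ℕ → Poly
lookupL []       n       = []
lookupL (x ∷ xs) zero    = x
lookupL (x ∷ xs) (suc n) = lookupL xs n

Series : Set
Series = ℕ → Poly

mulS : Series → Series → Series
mulS A B n = sumP (map (λ i → A i *P B (n ∸ i)) (upTo (suc n)))

powS : Series → ℕ → Series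
powS F zero    zero    = constP 1ℚ
powS F zero    (suc n) = []
powS F (suc m) n       = mulS F (powS F m) n

Fser : Series
Fser zero    = []
Fser (suc i) = scaleP (signQ (suc i) ℚ.* recipℕ (suc i)) (p (suc i))

-- coefficient of z^n in  H[-zx] = exp(Σ_{i≥1} p_i (-z)^i / i) = Σ_m F^m / m!
-- (F has no constant term, so only m ≤ n contribute)
Hc : ℕ → Poly
Hc n = sumP (map (λ m → scaleP (recipℕ (m !)) (powS Fser m n)) (upTo (suc n)))

-- D_k f = coefficient of z^k in H[-zx] f[x + M/z]
--       = Σ_{m ≥ 0, k+m ≥ 0} Hc(k+m) · [z^{-m}] f[x+M/z]
Dpoly : ℤ → Poly → Poly
Dpoly k f = sumP (map term (upTo (length (pleth f))))
  where
  term : ℕ → Poly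
  term m with k ℤ.+ (+ m)
  ... | + n      = Hc n *P lookupL (pleth f) m
  ... | -[1+ _ ] = []

D : ℤ → Λ → Λ
D k (f /Λ d) = Dpoly k f /Λ d

{-# OPTIONS --safe #-}
module Submission where

-- Everything is proved by duality. A polynomial in q, t, p₁, p₂, … is determined by the
-- values ∫ f ψ of its linear extension against all weight functions ψ on monomials, and each
-- operator of the statement is the transpose of an explicit operation on weight functions.
-- Multiplying a monomial by p_j multiplies its plethystic substitution f[x + M/z] by
-- p_j + M_j z^(-j), which gives D_k p_j = p_j D_k + M_j D_(k+j). Dually, p_j^⊥ = j ∂/∂p_j is a
-- derivation that annihilates the shift M_j z^(-j) and satisfies j ∂_j H_n[-zx] = (-1)^j H_(n-j),
-- which gives j ∂_j D_k = (-1)^j D_(k-j) + D_k j ∂_j. An operator P adjoint to p_j^• must act as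
-- j ∂/∂p_j, as one sees by pairing with single power-sum monomials p_λ, whose Hall norms z_λ are
-- nonzero. Both identities then follow by clearing denominators with a ring solver.

open import Defs

module FormalSum where

  open import Data.Nat as ℕ using (suc)
  open import Data.Rational as ℚ using (ℚ; 0ℚ; 1ℚ; _+_; _*_; -_; _-_)
  import Data.Rational.Properties as QP
  open import Data.List using (List; []; _∷_; _++_; length)
  open import Data.Product using (_×_; _,_)
  open import Data.Bool using (Bool; true; false; T; if_then_else_)
  open import Data.Unit using (tt)
  open import Relation.Binary.PropositionalEquality
  import Data.Nat.Properties as NP
  import Data.List.Properties as LP
  open import Data.Rational.Solver using (module +-*-Solver)
  open +-*-Solver

  record MonomialStructure : Set₁ where
    field
      M : Set
      _~_ : M → M → Bool
      ~refl : ∀ m → T (m ~ m)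
      ~sym : ∀ m n → T (m ~ n) → T (n ~ m)
      ~trans : ∀ m n o → T (m ~ n) → T (n ~ o) → T (m ~ o)
      _·_ : M → M → M
      ·-congˡ : ∀ a a' b → T (a ~ a') → T ((a · b) ~ (a' · b))
      ·-comm : ∀ a b → T ((a · b) ~ (b · a))
      ·-assoc : ∀ a b c → T (((a · b) · c) ~ (a · (b · c)))

  module Sums (Sp : MonomialStructure) where
    open MonomialStructure Sp public

    FSum : Set
    FSum = List (ℚ × M)

    ∫ : FSum → (M → ℚ) → ℚ
    ∫ [] ψ = 0ℚ
    ∫ ((c , m) ∷ f) ψ = c * ψ m + ∫ f ψ

    WellDefined : (M → ℚ) → Set
    WellDefined ψ = ∀ m n → T (m ~ n) → ψ m ≡ ψ n

    infix 4 _≈_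
    _≈_ : FSum → FSum → Set
    f ≈ g = ∀ ψ → WellDefined ψ → ∫ f ψ ≡ ∫ g ψ

    ≈refl : ∀ {f} → f ≈ f
    ≈refl ψ r = refl
    ≈sym : ∀ {f g} → f ≈ g → g ≈ f
    ≈sym e ψ r = sym (e ψ r)
    ≈trans : ∀ {f g h} → f ≈ g → g ≈ h → f ≈ h
    ≈trans e e' ψ r = trans (e ψ r) (e' ψ r)

    ·-congʳ : ∀ a b b' → T (b ~ b') → T ((a · b) ~ (a · b'))
    ·-congʳ a b b' e = ~trans _ _ _ (·-comm a b) (~trans _ _ _ (·-congˡ b b' a e) (·-comm b' a))

    ∫-++ : ∀ f g ψ → ∫ (f ++ g) ψ ≡ ∫ f ψ + ∫ g ψ
    ∫-++ [] g ψ = sym (QP.+-identityˡ _)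
    ∫-++ ((c , m) ∷ f) g ψ rewrite ∫-++ f g ψ = sym (QP.+-assoc (c * ψ m) (∫ f ψ) (∫ g ψ))

    ∫-ext : ∀ f {ψ ψ'} → (∀ m → ψ m ≡ ψ' m) → ∫ f ψ ≡ ∫ f ψ'
    ∫-ext [] e = refl
    ∫-ext ((c , m) ∷ f) e = cong₂ _+_ (cong (c *_) (e m)) (∫-ext f e)

    ∫-zero : ∀ f → ∫ f (λ _ → 0ℚ) ≡ 0ℚ
    ∫-zero [] = refl
    ∫-zero ((c , m) ∷ f) rewrite ∫-zero f | QP.*-zeroʳ c = refl

    ∫-+ : ∀ f ψ φ → ∫ f (λ m → ψ m + φ m) ≡ ∫ f ψ + ∫ f φ
    ∫-+ [] ψ φ = refl
    ∫-+ ((c , m) ∷ f) ψ φ rewrite ∫-+ f ψ φ =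
      solve 5 (λ c a b x y → c :* (a :+ b) :+ (x :+ y) := (c :* a :+ x) :+ (c :* b :+ y)) refl c (ψ m) (φ m) (∫ f ψ) (∫ f φ)

    ∫-* : ∀ f s ψ → ∫ f (λ m → s * ψ m) ≡ s * ∫ f ψ
    ∫-* [] s ψ = sym (QP.*-zeroʳ s)
    ∫-* ((c , m) ∷ f) s ψ rewrite ∫-* f s ψ =
      solve 4 (λ c s a x → c :* (s :* a) :+ s :* x := s :* (c :* a :+ x)) refl c s (ψ m) (∫ f ψ)

    ∫-swap : ∀ f g (χ : M → M → ℚ) → ∫ f (λ a → ∫ g (λ b → χ a b)) ≡ ∫ g (λ b → ∫ f (λ a → χ a b))
    ∫-swap [] g χ = sym (∫-zero g)
    ∫-swap ((c , m) ∷ f) g χ = begin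
        c * ∫ g (λ b → χ m b) + ∫ f (λ a → ∫ g (λ b → χ a b))
      ≡⟨ cong₂ _+_ (sym (∫-* g c (χ m))) (∫-swap f g χ) ⟩
        ∫ g (λ b → c * χ m b) + ∫ g (λ b → ∫ f (λ a → χ a b))
      ≡⟨ sym (∫-+ g _ _) ⟩
        ∫ g (λ b → c * χ m b + ∫ f (λ a → χ a b)) ∎
      where open ≡-Reasoning

    χ : M → M → ℚ
    χ n m = if m ~ n then 1ℚ else 0ℚ

    coef : FSum → M → ℚ
    coef f n = ∫ f (χ n)

    private
      F⇒⊥ : ∀ {ℓ} {A : Set ℓ} → T false → A
      F⇒⊥ ()

    χ-self : ∀ n → χ n n ≡ 1ℚ
    χ-self n with n ~ n in p
    ... | true = refl
    ... | false = F⇒⊥ (subst T p (~refl n))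

    χ-wellDefined : ∀ n → WellDefined (χ n)
    χ-wellDefined n m m' e with m ~ n in p | m' ~ n in p'
    ... | true | true = refl
    ... | false | false = refl
    ... | true | false = F⇒⊥ (subst T p' (~trans _ _ _ (~sym _ _ e) (subst T (sym p) tt)))
    ... | false | true = F⇒⊥ (subst T p (~trans _ _ _ e (subst T (sym p') tt)))

    keepClass dropClass : M → FSum → FSum
    keepClass m [] = []
    keepClass m ((c , x) ∷ f) = if m ~ x then (c , x) ∷ keepClass m f else keepClass m f
    dropClass m [] = []
    dropClass m ((c , x) ∷ f) = if m ~ x then dropClass m f else (c , x) ∷ dropClass m f

    mass : FSum → ℚ
    mass f = ∫ f (λ _ → 1ℚ)

    ∫-split : ∀ m f ψ → WellDefined ψ → ∫ f ψ ≡ mass (keepClass m f) * ψ m + ∫ (dropClass m f) ψ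
    ∫-split m [] ψ r = sym (trans (QP.+-identityʳ _) (QP.*-zeroˡ (ψ m)))
    ∫-split m ((c , x) ∷ f) ψ r with m ~ x in p
    ... | true rewrite ∫-split m f ψ r | r x m (~sym m x (subst T (sym p) tt)) =
      solve 4 (λ c k y d → c :* y :+ (k :* y :+ d) := (c :* con 1ℚ :+ k) :* y :+ d) refl c (mass (keepClass m f)) (ψ m) (∫ (dropClass m f) ψ)
    ... | false rewrite ∫-split m f ψ r =
      solve 3 (λ a b d → a :+ (b :+ d) := b :+ (a :+ d)) refl (c * ψ x) (mass (keepClass m f) * ψ m) (∫ (dropClass m f) ψ)

    ∫-cons-split : ∀ c m f ψ → WellDefined ψ →
      ∫ ((c , m) ∷ f) ψ ≡ (c + mass (keepClass m f)) * ψ m + ∫ (dropClass m f) ψ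
    ∫-cons-split c m f ψ r rewrite ∫-split m f ψ r =
      solve 4 (λ c k y d → c :* y :+ (k :* y :+ d) := (c :+ k) :* y :+ d) refl c (mass (keepClass m f)) (ψ m) (∫ (dropClass m f) ψ)

    ∫-dropClass-χ : ∀ m f → ∫ (dropClass m f) (χ m) ≡ 0ℚ
    ∫-dropClass-χ m [] = refl
    ∫-dropClass-χ m ((c , x) ∷ f) with m ~ x in p
    ... | true = ∫-dropClass-χ m f
    ... | false with x ~ m in p'
    ...   | true = F⇒⊥ (subst T p (~sym x m (subst T (sym p') tt)))
    ...   | false rewrite ∫-dropClass-χ m f | QP.*-zeroʳ c = refl

    length-dropClass : ∀ m f → length (dropClass m f) ℕ.≤ length f
    length-dropClass m [] = ℕ.z≤n
    length-dropClass m ((c , x) ∷ f) with m ~ x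
    ... | true = NP.m≤n⇒m≤1+n (length-dropClass m f)
    ... | false = ℕ.s≤s (length-dropClass m f)

    -- Induction on the number of terms: the class of the first monomial has total coefficient
    -- coef f m = 0, and removing it leaves a shorter sum whose coefficients still vanish.
    coef-zero⇒∫-zero : ∀ k f → length f ℕ.≤ k → (∀ n → coef f n ≡ 0ℚ) → ∀ ψ → WellDefined ψ → ∫ f ψ ≡ 0ℚ
    coef-zero⇒∫-zero k [] _ h ψ r = refl
    coef-zero⇒∫-zero (suc k) ((c , m) ∷ f) (ℕ.s≤s le) h ψ r = begin
        ∫ ((c , m) ∷ f) ψ
      ≡⟨ ∫-cons-split c m f ψ r ⟩
        C * ψ m + ∫ rest ψ
      ≡⟨ cong₂ (λ u v → u * ψ m + v) C≡0 (coef-zero⇒∫-zero k rest (NP.≤-trans (length-dropClass m f) le) rest-coef ψ r) ⟩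
        0ℚ * ψ m + 0ℚ
      ≡⟨ solve 1 (λ y → con 0ℚ :* y :+ con 0ℚ := con 0ℚ) refl (ψ m) ⟩
        0ℚ ∎
      where
      open ≡-Reasoning
      C = c + mass (keepClass m f)
      rest = dropClass m f
      coef-split : ∀ n → coef ((c , m) ∷ f) n ≡ C * χ n m + coef rest n
      coef-split n = ∫-cons-split c m f (χ n) (χ-wellDefined n)
      C≡0 : C ≡ 0ℚ
      C≡0 = begin
          C
        ≡⟨ solve 1 (λ x → x := x :* con 1ℚ :+ con 0ℚ) refl C ⟩
          C * 1ℚ + 0ℚ
        ≡⟨ sym (cong₂ (λ u v → C * u + v) (χ-self m) (∫-dropClass-χ m f)) ⟩
          C * χ m m + coef rest m
        ≡⟨ trans (sym (coef-split m)) (h m) ⟩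
          0ℚ ∎
      rest-coef : ∀ n → coef rest n ≡ 0ℚ
      rest-coef n = begin
          coef rest n
        ≡⟨ solve 2 (λ y d → d := con 0ℚ :* y :+ d) refl (χ n m) (coef rest n) ⟩
          0ℚ * χ n m + coef rest n
        ≡⟨ cong (λ u → u * χ n m + coef rest n) (sym C≡0) ⟩
          C * χ n m + coef rest n
        ≡⟨ trans (sym (coef-split n)) (h n) ⟩
          0ℚ ∎

    negate : FSum → FSum
    negate [] = []
    negate ((c , m) ∷ f) = (- c , m) ∷ negate f

    ∫-negate : ∀ f ψ → ∫ (negate f) ψ ≡ - ∫ f ψ
    ∫-negate [] ψ = refl
    ∫-negate ((c , m) ∷ f) ψ rewrite ∫-negate f ψ = solve 3 (λ c a x → (:- c) :* a :+ (:- x) := :- (c :* a :+ x)) refl c (ψ m) (∫ f ψ)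

    coef⇒≈ : ∀ f g → (∀ n → coef f n ≡ coef g n) → f ≈ g
    coef⇒≈ f g e ψ r = begin
        ∫ f ψ
      ≡⟨ solve 2 (λ a b → a := (a :+ (:- b)) :+ b) refl (∫ f ψ) (∫ g ψ) ⟩
        (∫ f ψ + - ∫ g ψ) + ∫ g ψ
      ≡⟨ cong (_+ ∫ g ψ) (trans (cong (∫ f ψ +_) (sym (∫-negate g ψ))) (sym (∫-++ f (negate g) ψ))) ⟩
        ∫ (f ++ negate g) ψ + ∫ g ψ
      ≡⟨ cong (_+ ∫ g ψ) (coef-zero⇒∫-zero _ (f ++ negate g) NP.≤-refl h ψ r) ⟩
        0ℚ + ∫ g ψ
      ≡⟨ QP.+-identityˡ _ ⟩
        ∫ g ψ ∎
      where
      open ≡-Reasoning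
      h : ∀ n → coef (f ++ negate g) n ≡ 0ℚ
      h n rewrite ∫-++ f (negate g) (χ n) | ∫-negate g (χ n) | e n = QP.+-inverseʳ (coef g n)

    ≈⇒coef : ∀ {f g} → f ≈ g → ∀ n → coef f n ≡ coef g n
    ≈⇒coef e n = e (χ n) (χ-wellDefined n)

    wellDefined-∫· : ∀ g ψ → WellDefined ψ → WellDefined (λ a → ∫ g (λ b → ψ (a · b)))
    wellDefined-∫· g ψ r a a' e = ∫-ext g (λ b → r _ _ (·-congˡ a a' b e))

    wellDefined-·ʳ : ∀ a ψ → WellDefined ψ → WellDefined (λ b → ψ (a · b))
    wellDefined-·ʳ a ψ r b b' e = r _ _ (·-congʳ a b b' e)

    module Multiplicative (mul : FSum → FSum → FSum)
               (∫-mul : ∀ f g ψ → ∫ (mul f g) ψ ≡ ∫ f (λ a → ∫ g (λ b → ψ (a · b)))) where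

      *-cong : ∀ {f f' g g'} → f ≈ f' → g ≈ g' → mul f g ≈ mul f' g'
      *-cong {f} {f'} {g} {g'} e e' ψ r = begin
          ∫ (mul f g) ψ
        ≡⟨ ∫-mul f g ψ ⟩
          ∫ f (λ a → ∫ g (λ b → ψ (a · b)))
        ≡⟨ ∫-ext f (λ a → e' _ (wellDefined-·ʳ a ψ r)) ⟩
          ∫ f (λ a → ∫ g' (λ b → ψ (a · b)))
        ≡⟨ e _ (wellDefined-∫· g' ψ r) ⟩
          ∫ f' (λ a → ∫ g' (λ b → ψ (a · b)))
        ≡⟨ sym (∫-mul f' g' ψ) ⟩
          ∫ (mul f' g') ψ ∎
        where open ≡-Reasoning

      *-comm : ∀ f g → mul f g ≈ mul g f
      *-comm f g ψ r = begin
          ∫ (mul f g) ψ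
        ≡⟨ ∫-mul f g ψ ⟩
          ∫ f (λ a → ∫ g (λ b → ψ (a · b)))
        ≡⟨ ∫-swap f g _ ⟩
          ∫ g (λ b → ∫ f (λ a → ψ (a · b)))
        ≡⟨ ∫-ext g (λ b → ∫-ext f (λ a → r _ _ (·-comm a b))) ⟩
          ∫ g (λ b → ∫ f (λ a → ψ (b · a)))
        ≡⟨ sym (∫-mul g f ψ) ⟩
          ∫ (mul g f) ψ ∎
        where open ≡-Reasoning

      *-assoc : ∀ f g h → mul (mul f g) h ≈ mul f (mul g h)
      *-assoc f g h ψ r = begin
          ∫ (mul (mul f g) h) ψ
        ≡⟨ ∫-mul (mul f g) h ψ ⟩
          ∫ (mul f g) (λ a → ∫ h (λ b → ψ (a · b)))
        ≡⟨ ∫-mul f g _ ⟩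
          ∫ f (λ a → ∫ g (λ b → ∫ h (λ c → ψ ((a · b) · c))))
        ≡⟨ ∫-ext f (λ a → ∫-ext g (λ b → ∫-ext h (λ c → r _ _ (·-assoc a b c)))) ⟩
          ∫ f (λ a → ∫ g (λ b → ∫ h (λ c → ψ (a · (b · c)))))
        ≡⟨ ∫-ext f (λ a → sym (∫-mul g h _)) ⟩
          ∫ f (λ a → ∫ (mul g h) (λ b → ψ (a · b)))
        ≡⟨ sym (∫-mul f (mul g h) ψ) ⟩
          ∫ (mul f (mul g h)) ψ ∎
        where open ≡-Reasoning

      *-distʳ : ∀ f g h → mul (f ++ g) h ≈ (mul f h ++ mul g h)
      *-distʳ f g h ψ r rewrite ∫-mul (f ++ g) h ψ | ∫-++ (mul f h) (mul g h) ψ | ∫-mul f h ψ | ∫-mul g h ψ = ∫-++ f g _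

      *-distˡ : ∀ f g h → mul h (f ++ g) ≈ (mul h f ++ mul h g)
      *-distˡ f g h ψ r rewrite ∫-mul h (f ++ g) ψ | ∫-++ (mul h f) (mul h g) ψ | ∫-mul h f ψ | ∫-mul h g ψ =
        trans (∫-ext h (λ a → ∫-++ f g _)) (∫-+ h _ _)

    ++-cong : ∀ {f f' g g'} → f ≈ f' → g ≈ g' → (f ++ g) ≈ (f' ++ g')
    ++-cong {f} {f'} {g} {g'} e e' ψ r rewrite ∫-++ f g ψ | ∫-++ f' g' ψ | e ψ r | e' ψ r = refl

    ++-comm : ∀ f g → (f ++ g) ≈ (g ++ f)
    ++-comm f g ψ r rewrite ∫-++ f g ψ | ∫-++ g f ψ = QP.+-comm (∫ f ψ) (∫ g ψ)

    ++-assoc : ∀ f g h → ((f ++ g) ++ h) ≈ (f ++ (g ++ h))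
    ++-assoc f g h ψ r rewrite LP.++-assoc f g h = refl

    ++-idʳ : ∀ f → (f ++ []) ≈ f
    ++-idʳ f ψ r rewrite LP.++-identityʳ f = refl


module Monomials where

  open import Data.Nat as ℕ using (ℕ; zero; suc)
  import Data.Nat.Properties as NP
  open import Data.Rational as ℚ using (ℚ; 1ℚ; _+_; _*_; -_; _-_)
  import Data.Rational.Properties as QP
  open import Data.List using (List; []; _∷_; map)
  open import Data.Product using (_×_; _,_; proj₁; proj₂)
  open import Data.Bool using (true; false; T; _∧_)
  open import Data.Bool.Properties using (T-∧)
  open import Function.Bundles using (Equivalence)
  open import Data.Unit using (tt)
  open import Relation.Binary.PropositionalEquality
  open import Data.Rational.Solver using (module +-*-Solver)
  open +-*-Solver
  open import Defs
  open FormalSum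

  nth : List ℕ → ℕ → ℕ
  nth [] i = 0
  nth (x ∷ xs) zero = x
  nth (x ∷ xs) (suc i) = nth xs i

  ∧-intro : ∀ {a b} → T a → T b → T (a ∧ b)
  ∧-intro x y = Equivalence.from T-∧ (x , y)
  ∧-l : ∀ a {b} → T (a ∧ b) → T a
  ∧-l true x = tt
  ∧-r : ∀ a {b} → T (a ∧ b) → T b
  ∧-r true x = x

  expEq⇒ : ∀ α β → T (expEq α β) → ∀ i → nth α i ≡ nth β i
  expEq⇒ [] [] e i = refl
  expEq⇒ [] (y ∷ ys) e zero = sym (NP.≡ᵇ⇒≡ y 0 (∧-l (y ℕ.≡ᵇ 0) e))
  expEq⇒ [] (y ∷ ys) e (suc i) = expEq⇒ [] ys (∧-r (y ℕ.≡ᵇ 0) e) i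
  expEq⇒ (x ∷ xs) [] e zero = NP.≡ᵇ⇒≡ x 0 (∧-l (x ℕ.≡ᵇ 0) e)
  expEq⇒ (x ∷ xs) [] e (suc i) = expEq⇒ xs [] (∧-r (x ℕ.≡ᵇ 0) e) i
  expEq⇒ (x ∷ xs) (y ∷ ys) e zero = NP.≡ᵇ⇒≡ x y (∧-l (x ℕ.≡ᵇ y) e)
  expEq⇒ (x ∷ xs) (y ∷ ys) e (suc i) = expEq⇒ xs ys (∧-r (x ℕ.≡ᵇ y) e) i

  ⇒expEq : ∀ α β → (∀ i → nth α i ≡ nth β i) → T (expEq α β)
  ⇒expEq [] [] e = tt
  ⇒expEq [] (y ∷ ys) e = ∧-intro (NP.≡⇒≡ᵇ y 0 (sym (e 0))) (⇒expEq [] ys (λ i → e (suc i)))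
  ⇒expEq (x ∷ xs) [] e = ∧-intro (NP.≡⇒≡ᵇ x 0 (e 0)) (⇒expEq xs [] (λ i → e (suc i)))
  ⇒expEq (x ∷ xs) (y ∷ ys) e = ∧-intro (NP.≡⇒≡ᵇ x y (e 0)) (⇒expEq xs ys (λ i → e (suc i)))

  nth-addExp : ∀ α β i → nth (addExp α β) i ≡ nth α i ℕ.+ nth β i
  nth-addExp [] β i = refl
  nth-addExp (x ∷ xs) [] i = sym (NP.+-identityʳ _)
  nth-addExp (x ∷ xs) (y ∷ ys) zero = refl
  nth-addExp (x ∷ xs) (y ∷ ys) (suc i) = nth-addExp xs ys i

  record MEq (m n : Mono) : Set where
    constructor meq
    field
      eqq : qe m ≡ qe n
      eqt : te m ≡ te n
      eqp : ∀ i → nth (pe m) i ≡ nth (pe n) i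

  toMEq : ∀ m n → T (monoEq m n) → MEq m n
  toMEq (mono a b α) (mono c d β) e =
    meq (NP.≡ᵇ⇒≡ a c (∧-l (a ℕ.≡ᵇ c) e)) (NP.≡ᵇ⇒≡ b d (∧-l (b ℕ.≡ᵇ d) (∧-r (a ℕ.≡ᵇ c) e))) (expEq⇒ α β (∧-r (b ℕ.≡ᵇ d) (∧-r (a ℕ.≡ᵇ c) e)))

  fromMEq : ∀ m n → MEq m n → T (monoEq m n)
  fromMEq (mono a b α) (mono c d β) (meq x y z) =
    ∧-intro (NP.≡⇒≡ᵇ a c x) (∧-intro (NP.≡⇒≡ᵇ b d y) (⇒expEq α β z))

  ε : Mono
  ε = mono 0 0 []

  monomialStructure : MonomialStructure
  monomialStructure = record
    { M = Mono
    ; _~_ = monoEq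
    ; ~refl = λ m → fromMEq m m (meq refl refl (λ i → refl))
    ; ~sym = λ m n e → let open MEq (toMEq m n e) in fromMEq n m (meq (sym eqq) (sym eqt) (λ i → sym (eqp i)))
    ; ~trans = λ m n o e e' → let E = toMEq m n e ; E' = toMEq n o e' in
         fromMEq m o (meq (trans (MEq.eqq E) (MEq.eqq E')) (trans (MEq.eqt E) (MEq.eqt E')) (λ i → trans (MEq.eqp E i) (MEq.eqp E' i)))
    ; _·_ = monoMul
    ; ·-congˡ = λ { (mono a b α) (mono a' b' α') (mono c d γ) e → let open MEq (toMEq (mono a b α) (mono a' b' α') e) in
         fromMEq (mono (a ℕ.+ c) (b ℕ.+ d) (addExp α γ)) (mono (a' ℕ.+ c) (b' ℕ.+ d) (addExp α' γ))
           (meq (cong (ℕ._+ c) eqq) (cong (ℕ._+ d) eqt)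
             (λ i → trans (nth-addExp α γ i) (trans (cong (ℕ._+ nth γ i) (eqp i)) (sym (nth-addExp α' γ i))))) }
    ; ·-comm = λ { (mono a b α) (mono c d γ) →
         fromMEq (mono (a ℕ.+ c) (b ℕ.+ d) (addExp α γ)) (mono (c ℕ.+ a) (d ℕ.+ b) (addExp γ α))
           (meq (NP.+-comm a c) (NP.+-comm b d) (λ i → trans (nth-addExp α γ i) (trans (NP.+-comm (nth α i) _) (sym (nth-addExp γ α i))))) }
    ; ·-assoc = λ { (mono a b α) (mono c d γ) (mono e f δ) →
         fromMEq (mono (a ℕ.+ c ℕ.+ e) (b ℕ.+ d ℕ.+ f) (addExp (addExp α γ) δ)) (mono (a ℕ.+ (c ℕ.+ e)) (b ℕ.+ (d ℕ.+ f)) (addExp α (addExp γ δ)))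
           (meq (NP.+-assoc a c e) (NP.+-assoc b d f)
             (λ i → trans (nth-addExp (addExp α γ) δ i) (trans (cong (ℕ._+ nth δ i) (nth-addExp α γ i))
                (trans (NP.+-assoc (nth α i) _ _) (trans (cong (nth α i ℕ.+_) (sym (nth-addExp γ δ i))) (sym (nth-addExp α (addExp γ δ) i))))))) }
    }

  open Sums monomialStructure public

  ∫-scaleP : ∀ s f ψ → ∫ (scaleP s f) ψ ≡ s * ∫ f ψ
  ∫-scaleP s [] ψ = sym (QP.*-zeroʳ s)
  ∫-scaleP s ((c , m) ∷ f) ψ rewrite ∫-scaleP s f ψ =
    solve 4 (λ s c a x → s :* c :* a :+ s :* x := s :* (c :* a :+ x)) refl s c (ψ m) (∫ f ψ)

  ∫-map-scale : ∀ c m (h : ℚ × Mono → ℚ × Mono) → (∀ x → h x ≡ (c * proj₁ x , monoMul m (proj₂ x))) →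
              ∀ g ψ → ∫ (map h g) ψ ≡ c * ∫ g (λ b → ψ (monoMul m b))
  ∫-map-scale c m h hx [] ψ = sym (QP.*-zeroʳ c)
  ∫-map-scale c m h hx ((c' , m') ∷ g) ψ rewrite hx (c' , m') | ∫-map-scale c m h hx g ψ =
    solve 4 (λ s c a x → s :* c :* a :+ s :* x := s :* (c :* a :+ x)) refl c c' (ψ (monoMul m m')) (∫ g (λ b → ψ (monoMul m b)))

  ∫-*P : ∀ f g ψ → ∫ (f *P g) ψ ≡ ∫ f (λ a → ∫ g (λ b → ψ (monoMul a b)))
  ∫-*P [] g ψ = refl
  ∫-*P ((c , m) ∷ f) g ψ = trans (∫-++ (map _ g) (f *P g) ψ) (cong₂ _+_ (∫-map-scale c m _ (λ x → refl) g ψ) (∫-*P f g ψ))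

  open Multiplicative _*P_ ∫-*P public

  ∫-constP : ∀ c ψ → ∫ (constP c) ψ ≡ c * ψ (mono 0 0 [])
  ∫-constP c ψ = QP.+-identityʳ _

  ∫-negP : ∀ f ψ → ∫ (scaleP (- 1ℚ) f) ψ ≡ - ∫ f ψ
  ∫-negP f ψ = trans (∫-scaleP (- 1ℚ) f ψ) (solve 1 (λ x → (:- con 1ℚ) :* x := :- x) refl (∫ f ψ))

  coeff≡coef : ∀ f m → coeff f m ≡ coef f m
  coeff≡coef [] m = refl
  coeff≡coef ((c , m') ∷ f) m with monoEq m' m
  ... | true = cong₂ _+_ (sym (QP.*-identityʳ c)) (coeff≡coef f m)
  ... | false = cong₂ _+_ (sym (QP.*-zeroʳ c)) (coeff≡coef f m)

  ≈P⇒≈ : ∀ {f g} → f ≈P g → f ≈ g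
  ≈P⇒≈ {f} {g} e = coef⇒≈ f g (λ n → trans (sym (coeff≡coef f n)) (trans (e n) (coeff≡coef g n)))

  ≈⇒≈P : ∀ {f g} → f ≈ g → f ≈P g
  ≈⇒≈P {f} {g} e n = trans (coeff≡coef f n) (trans (≈⇒coef {f} {g} e n) (sym (coeff≡coef g n)))

  -- A record rather than T (x ~ y), so that x and y can be inferred from a proof.
  infix 4 _≃_
  record _≃_ (x y : Mono) : Set where
    constructor ≃i
    field un≃ : T (x ~ y)
  open _≃_ public

  ≃sym : ∀ {x y} → x ≃ y → y ≃ x
  ≃sym {x} {y} (≃i e) = ≃i (~sym x y e)
  ≃trans : ∀ {x y z} → x ≃ y → y ≃ z → x ≃ z
  ≃trans {x} {y} {z} (≃i e) (≃i e') = ≃i (~trans x y z e e')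
  ≃congˡ : ∀ {x y} z → x ≃ y → (x · z) ≃ (y · z)
  ≃congˡ {x} {y} z (≃i e) = ≃i (·-congˡ x y z e)
  ≃congʳ : ∀ z {x y} → x ≃ y → (z · x) ≃ (z · y)
  ≃congʳ z {x} {y} (≃i e) = ≃i (·-congʳ z x y e)
  ≃comm : ∀ x y → (x · y) ≃ (y · x)
  ≃comm x y = ≃i (·-comm x y)
  ≃assoc : ∀ x y z → ((x · y) · z) ≃ (x · (y · z))
  ≃assoc x y z = ≃i (·-assoc x y z)
  ≃swap : ∀ x y z → (x · (y · z)) ≃ (y · (x · z))
  ≃swap x y z = ≃trans (≃sym (≃assoc x y z)) (≃trans (≃congˡ z (≃comm x y)) (≃assoc y x z))

  resp≃ : ∀ {ψ} → WellDefined ψ → ∀ {x y} → x ≃ y → ψ x ≡ ψ y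
  resp≃ r {x} {y} (≃i e) = r x y e


module PolynomialRing where

  open import Data.Nat as ℕ using (ℕ)
  open import Data.Rational as ℚ using (ℚ; 0ℚ; 1ℚ; _+_; _*_; -_)
  import Data.Rational.Properties as QP
  open import Data.List using ([]; _∷_; _++_; map)
  open import Data.Product using (_×_; _,_; proj₁; proj₂)
  open import Data.Maybe using (just; nothing)
  open import Relation.Nullary using (yes; no)
  open import Relation.Binary.PropositionalEquality
  import Relation.Binary
  import Relation.Binary.Reasoning.Setoid
  import Data.Maybe
  open import Algebra.Bundles using (CommutativeRing)
  open import Algebra.Solver.Ring.AlmostCommutativeRing
  import Algebra.Solver.Ring
  open import Defs
  open FormalSum
  open Monomials

  negP : Poly → Poly
  negP = scaleP (ℚ.- 1ℚ)

  1P : Poly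
  1P = constP 1ℚ

  infix 4 _≋_
  record _≋_ (f g : Poly) : Set where
    constructor ≋i
    field un≋ : f ≈ g
  open _≋_ public

  private
    ≋-isEq : Relation.Binary.IsEquivalence _≋_
    ≋-isEq = record { refl = λ {f} → ≋i (≈refl {f}) ; sym = λ {f} {g} e → ≋i (≈sym {f} {g} (un≋ e)) ; trans = λ {f} {g} {h} e e' → ≋i (≈trans {f} {g} {h} (un≋ e) (un≋ e')) }

  neg-cong : ∀ {f g} → f ≈ g → negP f ≈ negP g
  neg-cong {f} {g} e ψ r = trans (∫-negP f ψ) (trans (cong -_ (e ψ r)) (sym (∫-negP g ψ)))

  inv-r : ∀ f → (f ++ negP f) ≈ []
  inv-r f ψ r = trans (∫-++ f (negP f) ψ) (trans (cong (∫ f ψ +_) (∫-negP f ψ)) (QP.+-inverseʳ (∫ f ψ)))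

  inv-l : ∀ f → (negP f ++ f) ≈ []
  inv-l f ψ r = trans (∫-++ (negP f) f ψ) (trans (cong (_+ ∫ f ψ) (∫-negP f ψ)) (QP.+-inverseˡ (∫ f ψ)))

  *-idˡ : ∀ f → (1P *P f) ≈ f
  *-idˡ f ψ r rewrite ∫-*P 1P f ψ = trans (QP.+-identityʳ _) (QP.*-identityˡ _)

  *-idʳ : ∀ f → (f *P 1P) ≈ f
  *-idʳ f = ≈trans {f *P 1P} {1P *P f} {f} (*-comm f 1P) (*-idˡ f)

  polyRing : CommutativeRing _ _
  polyRing = record
    { Carrier = Poly ; _≈_ = _≋_ ; _+_ = _++_ ; _*_ = _*P_ ; -_ = negP ; 0# = [] ; 1# = 1P
    ; isCommutativeRing = record
      { isRing = record
        { +-isAbelianGroup = record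
          { isGroup = record
            { isMonoid = record
              { isSemigroup = record
                { isMagma = record { isEquivalence = ≋-isEq ; ∙-cong = λ {f} {f'} {g} {g'} e e' → ≋i (++-cong {f} {f'} {g} {g'} (un≋ e) (un≋ e')) }
                ; assoc = λ f g h → ≋i (++-assoc f g h) }
              ; identity = (λ f → ≋i (≈refl {f})) , (λ f → ≋i (++-idʳ f)) }
            ; inverse = (λ f → ≋i (inv-l f)) , (λ f → ≋i (inv-r f))
            ; ⁻¹-cong = λ {f} {g} e → ≋i (neg-cong {f} {g} (un≋ e)) }
          ; comm = λ f g → ≋i (++-comm f g) }
        ; *-cong = λ {f} {f'} {g} {g'} e e' → ≋i (*-cong {f} {f'} {g} {g'} (un≋ e) (un≋ e'))
        ; *-assoc = λ f g h → ≋i (*-assoc f g h)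
        ; *-identity = (λ f → ≋i (*-idˡ f)) , (λ f → ≋i (*-idʳ f))
        ; distrib = (λ h f g → ≋i (*-distˡ f g h)) , (λ h f g → ≋i (*-distʳ f g h)) }
      ; *-comm = λ f g → ≋i (*-comm f g) } }

  polyACR : AlmostCommutativeRing _ _
  polyACR = fromCommutativeRing polyRing

  constP-hom : ℚ.+-*-rawRing -Raw-AlmostCommutative⟶ polyACR
  constP-hom = record
    { ⟦_⟧ = constP
    ; +-homo = λ a b → ≋i λ ψ r → trans (∫-constP (a + b) ψ) (trans (QP.*-distribʳ-+ (ψ ε) a b)
          (sym (trans (∫-++ (constP a) (constP b) ψ) (cong₂ _+_ (∫-constP a ψ) (∫-constP b ψ)))))
    ; *-homo = λ a b → ≋i λ ψ r → trans (∫-constP (a * b) ψ) (trans (QP.*-assoc a b (ψ ε))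
          (sym (trans (∫-*P (constP a) (constP b) ψ) (trans (∫-constP a (λ m → ∫ (constP b) (λ c → ψ (monoMul m c)))) (cong (a *_) (∫-constP b (λ c → ψ (monoMul ε c))))))))
    ; -‿homo = λ a → ≋i λ ψ r → trans (∫-constP (- a) ψ) (trans (cong (_* ψ ε) (sym (QP.*-identityˡ (- a)))) (sym (trans (∫-negP (constP a) ψ) (trans (cong -_ (∫-constP a ψ)) (trans (QP.neg-distribˡ-* a (ψ ε)) (cong (_* ψ ε) (sym (QP.*-identityˡ (- a)))))))))
    ; 0-homo = ≋i λ ψ r → trans (∫-constP 0ℚ ψ) (QP.*-zeroˡ (ψ ε))
    ; 1-homo = ≋i λ ψ r → refl }

  constP≟ : ∀ a b → Data.Maybe.Maybe (constP a ≋ constP b)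
  constP≟ a b with a QP.≟ b
  ... | yes refl = just (≋i (≈refl {constP a}))
  ... | no _ = nothing

  module PolySolver = Algebra.Solver.Ring ℚ.+-*-rawRing polyACR constP-hom constP≟

  ≋refl : ∀ {f} → f ≋ f
  ≋refl {f} = ≋i (≈refl {f})

  ≋sym : ∀ {f g} → f ≋ g → g ≋ f
  ≋sym {f} {g} (≋i e) = ≋i (≈sym {f} {g} e)
  ≋trans : ∀ {f g h} → f ≋ g → g ≋ h → f ≋ h
  ≋trans {f} {g} {h} (≋i e) (≋i e') = ≋i (≈trans {f} {g} {h} e e')
  ≋* : ∀ {a b c d} → a ≋ b → c ≋ d → (a *P c) ≋ (b *P d)
  ≋* {a} {b} {c} {d} (≋i e) (≋i e') = ≋i (*-cong {a} {b} {c} {d} e e')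
  ≋+ : ∀ {a b c d} → a ≋ b → c ≋ d → (a ++ c) ≋ (b ++ d)
  ≋+ {a} {b} {c} {d} (≋i e) (≋i e') = ≋i (++-cong {a} {b} {c} {d} e e')
  ≋neg : ∀ {a b} → a ≋ b → negP a ≋ negP b
  ≋neg {a} {b} (≋i e) = ≋i (neg-cong {a} {b} e)

  ≋setoid : Relation.Binary.Setoid _ _
  ≋setoid = record { Carrier = Poly ; _≈_ = _≋_ ; isEquivalence = ≋-isEq }
  module ≋-Reasoning = Relation.Binary.Reasoning.Setoid ≋setoid

  ∫-emb-map-scale : ∀ c a b (h : ℚ × ℕ × ℕ → ℚ × ℕ × ℕ) → (∀ x → h x ≡ (c * proj₁ x , a ℕ.+ proj₁ (proj₂ x) , b ℕ.+ proj₂ (proj₂ x))) →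
              ∀ g ψ → ∫ (emb (map h g)) ψ ≡ c * ∫ (emb g) (λ y → ψ (mono a b [] · y))
  ∫-emb-map-scale c a b h hx [] ψ = sym (QP.*-zeroʳ c)
  ∫-emb-map-scale c a b h hx ((c' , a' , b') ∷ g) ψ rewrite hx (c' , a' , b') =
    trans (cong₂ _+_ (QP.*-assoc c c' _) (∫-emb-map-scale c a b h hx g ψ)) (sym (QP.*-distribˡ-+ c _ _))

  emb-++ : ∀ f g → emb (f ++ g) ≡ emb f ++ emb g
  emb-++ [] g = refl
  emb-++ (x ∷ f) g = cong (_ ∷_) (emb-++ f g)

  ∫-emb-ext : ∀ E {φ φ'} → (∀ a b → φ (mono a b []) ≡ φ' (mono a b [])) → ∫ (emb E) φ ≡ ∫ (emb E) φ'
  ∫-emb-ext [] h = refl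
  ∫-emb-ext ((c , a , b) ∷ E) h = cong₂ _+_ (cong (c *_) (h a b)) (∫-emb-ext E h)

  ∫-emb-++ : ∀ A B φ → ∫ (emb (A ++ B)) φ ≡ ∫ (emb A) φ + ∫ (emb B) φ
  ∫-emb-++ A B φ = trans (cong (λ z → ∫ z φ) (emb-++ A B)) (∫-++ (emb A) (emb B) φ)

  ∫-emb-*QT : ∀ f g ψ → ∫ (emb (f *QT g)) ψ ≡ ∫ (emb f) (λ x → ∫ (emb g) (λ y → ψ (x · y)))
  ∫-emb-*QT [] g ψ = refl
  ∫-emb-*QT ((c , a , b) ∷ f) g ψ =
    trans (cong (λ z → ∫ z ψ) (emb-++ (map _ g) (f *QT g)))
     (trans (∫-++ (emb (map _ g)) (emb (f *QT g)) ψ) (cong₂ _+_ (∫-emb-map-scale c a b _ (λ x → refl) g ψ) (∫-emb-*QT f g ψ)))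

  emb-*QT : ∀ f g → emb (f *QT g) ≋ (emb f *P emb g)
  emb-*QT f g = ≋i (λ ψ r → trans (∫-emb-*QT f g ψ) (sym (∫-*P (emb f) (emb g) ψ)))


module LaurentSum where

  open import Data.Nat as ℕ using (ℕ; zero; suc)
  import Data.Nat.Properties as NP
  open import Data.Rational as ℚ using (ℚ; 0ℚ; 1ℚ; _+_; _*_)
  import Data.Rational.Properties as QP
  open import Data.List using ([]; _∷_)
  open import Relation.Binary.PropositionalEquality
  open import Data.Rational.Solver using (module +-*-Solver)
  open +-*-Solver
  open import Defs
  open FormalSum
  open Monomials

  -- ∫L A w φ pairs the coefficient of z^(-v) in A with φ (w + v).
  ∫L : LPoly → ℕ → (ℕ → Mono → ℚ) → ℚ
  ∫L [] w φ = 0ℚ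
  ∫L (x ∷ xs) w φ = ∫ x (φ w) + ∫L xs (suc w) φ

  WellDefinedL : (ℕ → Mono → ℚ) → Set
  WellDefinedL φ = ∀ w → WellDefined (φ w)

  infix 4 _≈L_
  _≈L_ : LPoly → LPoly → Set
  A ≈L B = ∀ w φ → WellDefinedL φ → ∫L A w φ ≡ ∫L B w φ

  ∫L-ext : ∀ A w {φ φ'} → (∀ v m → φ v m ≡ φ' v m) → ∫L A w φ ≡ ∫L A w φ'
  ∫L-ext [] w e = refl
  ∫L-ext (x ∷ xs) w e = cong₂ _+_ (∫-ext x (e w)) (∫L-ext xs (suc w) e)

  ∫L-zero : ∀ A w → ∫L A w (λ _ _ → 0ℚ) ≡ 0ℚ
  ∫L-zero [] w = refl
  ∫L-zero (x ∷ xs) w = trans (cong₂ _+_ (∫-zero x) (∫L-zero xs (suc w))) (QP.+-identityʳ 0ℚ)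

  ∫L-+ : ∀ A w φ φ' → ∫L A w (λ v m → φ v m + φ' v m) ≡ ∫L A w φ + ∫L A w φ'
  ∫L-+ [] w φ φ' = refl
  ∫L-+ (x ∷ xs) w φ φ' = trans (cong₂ _+_ (∫-+ x (φ w) (φ' w)) (∫L-+ xs (suc w) φ φ'))
    (solve 4 (λ a b c d → (a :+ b) :+ (c :+ d) := (a :+ c) :+ (b :+ d)) refl (∫ x (φ w)) (∫ x (φ' w)) (∫L xs (suc w) φ) (∫L xs (suc w) φ'))

  ∫L-* : ∀ A w s φ → ∫L A w (λ v m → s * φ v m) ≡ s * ∫L A w φ
  ∫L-* [] w s φ = sym (QP.*-zeroʳ s)
  ∫L-* (x ∷ xs) w s φ = trans (cong₂ _+_ (∫-* x s (φ w)) (∫L-* xs (suc w) s φ)) (sym (QP.*-distribˡ-+ s _ _))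

  ∫L-suc : ∀ A w φ → ∫L A (suc w) φ ≡ ∫L A w (λ v → φ (suc v))
  ∫L-suc [] w φ = refl
  ∫L-suc (x ∷ xs) w φ = cong (∫ x (φ (suc w)) +_) (∫L-suc xs (suc w) φ)

  ∫L-offset : ∀ A w φ → ∫L A w φ ≡ ∫L A 0 (λ v → φ (w ℕ.+ v))
  ∫L-offset A zero φ = refl
  ∫L-offset A (suc w) φ = trans (∫L-suc A w φ) (∫L-offset A w (λ v → φ (suc v)))

  ∫-∫L-swap : ∀ f A w (χ : Mono → ℕ → Mono → ℚ) → ∫ f (λ a → ∫L A w (λ v b → χ a v b)) ≡ ∫L A w (λ v b → ∫ f (λ a → χ a v b))
  ∫-∫L-swap f [] w χ = ∫-zero f
  ∫-∫L-swap f (x ∷ xs) w χ = trans (∫-+ f _ _) (cong₂ _+_ (∫-swap f x _) (∫-∫L-swap f xs (suc w) χ))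

  ∫L-swap : ∀ A B w w' (χ : ℕ → Mono → ℕ → Mono → ℚ) →
    ∫L A w (λ v a → ∫L B w' (λ u b → χ v a u b)) ≡ ∫L B w' (λ u b → ∫L A w (λ v a → χ v a u b))
  ∫L-swap [] B w w' χ = sym (∫L-zero B w')
  ∫L-swap (x ∷ xs) B w w' χ = trans (cong₂ _+_ (∫-∫L-swap x B w' _) (∫L-swap xs B (suc w) w' χ)) (sym (∫L-+ B w' _ _))

  ∫L-addL : ∀ A B w φ → ∫L (addL A B) w φ ≡ ∫L A w φ + ∫L B w φ
  ∫L-addL [] B w φ = sym (QP.+-identityˡ _)
  ∫L-addL (x ∷ xs) [] w φ = sym (QP.+-identityʳ _)
  ∫L-addL (x ∷ xs) (y ∷ ys) w φ = trans (cong₂ _+_ (∫-++ x y (φ w)) (∫L-addL xs ys (suc w) φ))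
    (solve 4 (λ a b c d → (a :+ b) :+ (c :+ d) := (a :+ c) :+ (b :+ d)) refl (∫ x (φ w)) (∫ y (φ w)) (∫L xs (suc w) φ) (∫L ys (suc w) φ))

  ∫L-scaleLP : ∀ x B w φ → ∫L (scaleLP x B) w φ ≡ ∫ x (λ a → ∫L B w (λ v b → φ v (a · b)))
  ∫L-scaleLP x [] w φ = sym (∫-zero x)
  ∫L-scaleLP x (y ∷ ys) w φ = trans (cong₂ _+_ (∫-*P x y (φ w)) (∫L-scaleLP x ys (suc w) φ)) (sym (∫-+ x _ _))

  ∫L-mulL : ∀ A B w φ → ∫L (mulL A B) w φ ≡ ∫L A w (λ v a → ∫L B v (λ u b → φ u (a · b)))
  ∫L-mulL [] B w φ = refl
  ∫L-mulL (x ∷ xs) B w φ = trans (∫L-addL (scaleLP x B) ([] ∷ mulL xs B) w φ)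
     (cong₂ _+_ (∫L-scaleLP x B w φ) (trans (QP.+-identityˡ _) (∫L-mulL xs B (suc w) φ)))

  wellDefinedL-∫L· : ∀ B φ → WellDefinedL φ → WellDefinedL (λ v a → ∫L B v (λ u b → φ u (a · b)))
  wellDefinedL-∫L· B φ r v a a' e = ∫L-ext B v (λ u b → r u _ _ (·-congˡ a a' b e))

  wellDefinedL-·ʳ : ∀ Φ → WellDefinedL Φ → ∀ a → WellDefinedL (λ u b → Φ u (a · b))
  wellDefinedL-·ʳ Φ r a u b b' e = r u _ _ (·-congʳ a b b' e)

  mulL-cong : ∀ {A A' B B'} → A ≈L A' → B ≈L B' → mulL A B ≈L mulL A' B'
  mulL-cong {A} {A'} {B} {B'} e e' w φ r =
    trans (∫L-mulL A B w φ) (trans (∫L-ext A w (λ v a → e' v _ (λ u → wellDefined-·ʳ a (φ u) (r u))))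
     (trans (e w _ (wellDefinedL-∫L· B' φ r)) (sym (∫L-mulL A' B' w φ))))

  mulL-comm : ∀ A B → mulL A B ≈L mulL B A
  mulL-comm A B w φ r = begin
      ∫L (mulL A B) w φ
    ≡⟨ ∫L-mulL A B w φ ⟩
      ∫L A w (λ v a → ∫L B v (λ u b → φ u (a · b)))
    ≡⟨ ∫L-ext A w (λ v a → ∫L-offset B v _) ⟩
      ∫L A w (λ v a → ∫L B 0 (λ u b → φ (v ℕ.+ u) (a · b)))
    ≡⟨ ∫L-offset A w _ ⟩
      ∫L A 0 (λ v a → ∫L B 0 (λ u b → φ (w ℕ.+ v ℕ.+ u) (a · b)))
    ≡⟨ ∫L-swap A B 0 0 _ ⟩
      ∫L B 0 (λ u b → ∫L A 0 (λ v a → φ (w ℕ.+ v ℕ.+ u) (a · b)))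
    ≡⟨ ∫L-ext B 0 (λ u b → ∫L-ext A 0 (λ v a → trans (cong (λ n → φ n (a · b)) (trans (NP.+-assoc w v u) (trans (cong (w ℕ.+_) (NP.+-comm v u)) (sym (NP.+-assoc w u v))))) (r _ _ _ (·-comm a b)))) ⟩
      ∫L B 0 (λ u b → ∫L A 0 (λ v a → φ (w ℕ.+ u ℕ.+ v) (b · a)))
    ≡⟨ sym (∫L-ext B 0 (λ u b → ∫L-offset A (w ℕ.+ u) _)) ⟩
      ∫L B 0 (λ u b → ∫L A (w ℕ.+ u) (λ v a → φ v (b · a)))
    ≡⟨ sym (∫L-offset B w _) ⟩
      ∫L B w (λ u b → ∫L A u (λ v a → φ v (b · a)))
    ≡⟨ sym (∫L-mulL B A w φ) ⟩
      ∫L (mulL B A) w φ ∎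
    where open ≡-Reasoning

  mulL-assoc : ∀ A B C → mulL (mulL A B) C ≈L mulL A (mulL B C)
  mulL-assoc A B C w φ r = begin
      ∫L (mulL (mulL A B) C) w φ
    ≡⟨ ∫L-mulL (mulL A B) C w φ ⟩
      ∫L (mulL A B) w (λ v a → ∫L C v (λ u b → φ u (a · b)))
    ≡⟨ ∫L-mulL A B w _ ⟩
      ∫L A w (λ v a → ∫L B v (λ u b → ∫L C u (λ t c → φ t ((a · b) · c))))
    ≡⟨ ∫L-ext A w (λ v a → ∫L-ext B v (λ u b → ∫L-ext C u (λ t c → r t _ _ (·-assoc a b c)))) ⟩
      ∫L A w (λ v a → ∫L B v (λ u b → ∫L C u (λ t c → φ t (a · (b · c)))))
    ≡⟨ ∫L-ext A w (λ v a → sym (∫L-mulL B C v _)) ⟩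
      ∫L A w (λ v a → ∫L (mulL B C) v (λ u b → φ u (a · b)))
    ≡⟨ sym (∫L-mulL A (mulL B C) w φ) ⟩
      ∫L (mulL A (mulL B C)) w φ ∎
    where open ≡-Reasoning

  1L : LPoly
  1L = constP 1ℚ ∷ []

  mulL-idˡ : ∀ B → mulL 1L B ≈L B
  mulL-idˡ B w φ r = trans (∫L-mulL 1L B w φ) (trans (QP.+-identityʳ _) (trans (QP.+-identityʳ _) (QP.*-identityˡ _)))

  mulL-idʳ : ∀ B → mulL B 1L ≈L B
  mulL-idʳ B w φ r = trans (mulL-comm B 1L w φ r) (mulL-idˡ B w φ r)

  ≈L-refl : ∀ {A} → A ≈L A
  ≈L-refl w φ r = refl


module PlethysticShift where

  open import Data.Nat as ℕ using (ℕ; zero; suc)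
  import Data.Nat.Properties as NP
  import Data.Rational.Properties as QP
  open import Data.List using (List; []; _∷_; _++_; replicate)
  open import Data.Empty using (⊥-elim)
  open import Relation.Nullary using (¬_)
  open import Relation.Binary.PropositionalEquality
  open import Defs
  open FormalSum
  open Monomials
  open LaurentSum

  addExp-[] : ∀ xs → addExp xs [] ≡ xs
  addExp-[] [] = refl
  addExp-[] (x ∷ xs) = refl

  unitExp : ℕ → List ℕ
  unitExp r = replicate r 0 ++ (1 ∷ [])

  nth-unitExp-same : ∀ l → nth (unitExp l) l ≡ 1
  nth-unitExp-same zero = refl
  nth-unitExp-same (suc l) = nth-unitExp-same l

  nth-unitExp-diff : ∀ l t → ¬ t ≡ l → nth (unitExp l) t ≡ 0
  nth-unitExp-diff zero zero ne = ⊥-elim (ne refl)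
  nth-unitExp-diff zero (suc t) ne = refl
  nth-unitExp-diff (suc l) zero ne = refl
  nth-unitExp-diff (suc l) (suc t) ne = nth-unitExp-diff l t (λ e → ne (cong suc e))

  pMono : ℕ → Mono
  pMono i = mono 0 0 (unitExp i)

  ∫-p : ∀ i ψ → ∫ (p (suc i)) ψ ≡ ψ (pMono i)
  ∫-p i ψ = trans (QP.+-identityʳ _) (QP.*-identityˡ _)

  ∫-p*P : ∀ i F ψ → ∫ (p (suc i) *P F) ψ ≡ ∫ F (λ μ → ψ (pMono i · μ))
  ∫-p*P i F ψ = trans (∫-*P (p (suc i)) F ψ) (∫-p i (λ a → ∫ F (λ b → ψ (a · b))))

  ∫L-single : ∀ i E w φ → ∫L (replicate i [] ++ (E ∷ [])) w φ ≡ ∫ E (φ (i ℕ.+ w))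
  ∫L-single zero E w φ = QP.+-identityʳ _
  ∫L-single (suc i) E w φ = trans (QP.+-identityˡ _) (trans (∫L-single i E (suc w) φ) (cong (λ n → ∫ E (φ n)) (NP.+-suc i w)))

  plethMono-unitExp : ∀ r i α → plethMono i (addExp (unitExp r) α) ≈L mulL (pShift (r ℕ.+ i)) (plethMono i α)
  plethMono-unitExp zero i [] w φ r = mulL-cong {mulL (pShift i) 1L} {pShift i} {1L} {1L} (mulL-idʳ (pShift i)) (λ _ _ _ → refl) w φ r
  plethMono-unitExp zero i (a ∷ as) = mulL-assoc (pShift i) (powL (pShift i) a) (plethMono (suc i) as)
  plethMono-unitExp (suc r) i [] w φ rr = trans (mulL-idˡ (plethMono (suc i) (unitExp r)) w φ rr)
     (subst (λ z → ∫L (plethMono (suc i) z) w φ ≡ ∫L (mulL (pShift (suc (r ℕ.+ i))) 1L) w φ) (addExp-[] (unitExp r))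
       (subst (λ n → ∫L (plethMono (suc i) (addExp (unitExp r) [])) w φ ≡ ∫L (mulL (pShift n) 1L) w φ) (NP.+-suc r i) (plethMono-unitExp r (suc i) [] w φ rr)))
  plethMono-unitExp (suc r) i (a ∷ as) w φ rr =
    trans (mulL-cong {P} {P} {plethMono (suc i) (addExp (unitExp r) as)} {mulL B' R} (λ _ _ _ → refl) IH w φ rr)
    (trans (sym (mulL-assoc P B' R w φ rr))
    (trans (mulL-cong {mulL P B'} {mulL B' P} {R} {R} (mulL-comm P B') (λ _ _ _ → refl) w φ rr)
      (mulL-assoc B' P R w φ rr)))
    where
    P = powL (pShift i) a
    R = plethMono (suc i) as
    B' = pShift (suc (r ℕ.+ i))
    IH : plethMono (suc i) (addExp (unitExp r) as) ≈L mulL B' R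
    IH w φ rr = subst (λ n → ∫L (plethMono (suc i) (addExp (unitExp r) as)) w φ ≡ ∫L (mulL (pShift n) R) w φ) (NP.+-suc r i) (plethMono-unitExp r (suc i) as w φ rr)


module FiniteSum where

  open import Data.Nat as ℕ using (ℕ; zero; suc)
  open import Data.Rational as ℚ using (ℚ; 0ℚ; _+_; _*_)
  import Data.Rational.Properties as QP
  open import Relation.Binary.PropositionalEquality
  open import Data.Rational.Solver using (module +-*-Solver)
  open +-*-Solver

  Σ< : ℕ → (ℕ → ℚ) → ℚ
  Σ< zero h = 0ℚ
  Σ< (suc n) h = h 0 + Σ< n (λ i → h (suc i))

  Σ<-ext : ∀ n {h h'} → (∀ i → h i ≡ h' i) → Σ< n h ≡ Σ< n h'
  Σ<-ext zero e = refl
  Σ<-ext (suc n) e = cong₂ _+_ (e 0) (Σ<-ext n (λ i → e (suc i)))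

  Σ<-zero : ∀ n → Σ< n (λ _ → 0ℚ) ≡ 0ℚ
  Σ<-zero zero = refl
  Σ<-zero (suc n) = trans (QP.+-identityˡ _) (Σ<-zero n)

  Σ<-+ : ∀ n f g → Σ< n (λ a → f a + g a) ≡ Σ< n f + Σ< n g
  Σ<-+ zero f g = sym (QP.+-identityˡ 0ℚ)
  Σ<-+ (suc n) f g rewrite Σ<-+ n (λ a → f (suc a)) (λ a → g (suc a)) =
    solve 4 (λ a b c d → (a :+ b) :+ (c :+ d) := (a :+ c) :+ (b :+ d)) refl (f 0) (g 0) (Σ< n (λ a → f (suc a))) (Σ< n (λ a → g (suc a)))

  Σ<-* : ∀ n s f → Σ< n (λ a → s * f a) ≡ s * Σ< n f
  Σ<-* zero s f = sym (QP.*-zeroʳ s)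
  Σ<-* (suc n) s f = trans (cong (s * f 0 +_) (Σ<-* n s (λ a → f (suc a)))) (sym (QP.*-distribˡ-+ s _ _))

  Σ<-split : ∀ K L h → Σ< (K ℕ.+ L) h ≡ Σ< K h + Σ< L (λ m → h (K ℕ.+ m))
  Σ<-split zero L h = sym (QP.+-identityˡ _)
  Σ<-split (suc K) L h = trans (cong (h 0 +_) (Σ<-split K L (λ a → h (suc a)))) (sym (QP.+-assoc (h 0) (Σ< K (λ a → h (suc a))) (Σ< L (λ m → h (suc (K ℕ.+ m))))))


module Transpose where

  open import Data.Nat as ℕ using (ℕ; zero; suc)
  open import Data.Integer as ℤ using (ℤ; -[1+_])
  open import Data.Rational as ℚ using (ℚ; _+_; _*_)
  import Data.Rational.Properties as QP
  open import Data.List using ([]; _∷_; map; upTo; applyUpTo; length)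
  open import Data.Product using (Σ; _,_; proj₁)
  open import Relation.Binary.PropositionalEquality
  open import Defs
  open FormalSum
  open Monomials
  open LaurentSum
  open FiniteSum

  -- The summand of Dpoly is bound in a where clause of Defs and cannot be named directly;
  -- it is recovered here from the definitional unfolding of Dpoly.
  Dpoly-terms : ∀ k f → Σ (ℕ → Poly) (λ t → Dpoly k f ≡ sumP (map t (upTo (length (pleth f)))))
  Dpoly-terms k f = _ , refl

  Dterm : ℤ → Poly → ℕ → Poly
  Dterm k f = proj₁ (Dpoly-terms k f)

  Hℤ : ℤ → Poly
  Hℤ (ℤ.+ n) = Hc n
  Hℤ -[1+ _ ] = []

  Dterm≡ : ∀ k f m → Dterm k f m ≡ Hℤ (k ℤ.+ ℤ.+ m) *P lookupL (pleth f) m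
  Dterm≡ k f m with k ℤ.+ ℤ.+ m
  ... | ℤ.+ n = refl
  ... | -[1+ a ] = refl

  ∫-sumP-map : ∀ (t : ℕ → Poly) (g : ℕ → ℕ) n ψ → ∫ (sumP (map t (applyUpTo g n))) ψ ≡ Σ< n (λ i → ∫ (t (g i)) ψ)
  ∫-sumP-map t g zero ψ = refl
  ∫-sumP-map t g (suc n) ψ = trans (∫-++ (t (g 0)) _ ψ) (cong (∫ (t (g 0)) ψ +_) (∫-sumP-map t (λ i → g (suc i)) n ψ))

  ∫L-lookupL : ∀ L φ → ∫L L 0 φ ≡ Σ< (length L) (λ i → ∫ (lookupL L i) (φ i))
  ∫L-lookupL [] φ = refl
  ∫L-lookupL (x ∷ xs) φ = cong (∫ x (φ 0) +_) (trans (∫L-suc xs 0 φ) (∫L-lookupL xs (λ v → φ (suc v))))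

  Hweight : ℤ → (Mono → ℚ) → ℕ → Mono → ℚ
  Hweight k ψ v ν = ∫ (Hℤ (k ℤ.+ ℤ.+ v)) (λ a → ψ (a · ν))

  ∫-Dpoly-∫L : ∀ k f ψ → ∫ (Dpoly k f) ψ ≡ ∫L (pleth f) 0 (Hweight k ψ)
  ∫-Dpoly-∫L k f ψ = begin
      ∫ (sumP (map (Dterm k f) (applyUpTo (λ x → x) (length (pleth f))))) ψ
    ≡⟨ ∫-sumP-map (Dterm k f) (λ x → x) (length (pleth f)) ψ ⟩
      Σ< (length (pleth f)) (λ i → ∫ (Dterm k f i) ψ)
    ≡⟨ Σ<-ext (length (pleth f)) (λ i → trans (cong (λ z → ∫ z ψ) (Dterm≡ k f i))
          (trans (∫-*P (Hℤ (k ℤ.+ ℤ.+ i)) (lookupL (pleth f) i) ψ) (∫-swap (Hℤ (k ℤ.+ ℤ.+ i)) (lookupL (pleth f) i) _))) ⟩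
      Σ< (length (pleth f)) (λ i → ∫ (lookupL (pleth f) i) (Hweight k ψ i))
    ≡⟨ sym (∫L-lookupL (pleth f) (Hweight k ψ)) ⟩
      ∫L (pleth f) 0 (Hweight k ψ) ∎
    where open ≡-Reasoning

  qtPart : Mono → Mono
  qtPart μ = mono (qe μ) (te μ) []

  ∫L-pleth : ∀ f w φ → ∫L (pleth f) w φ ≡ ∫ f (λ μ → ∫L (plethMono 0 (pe μ)) w (λ v ν → φ v (qtPart μ · ν)))
  ∫L-pleth [] w φ = refl
  ∫L-pleth ((c , mono a b α) ∷ f) w φ =
    trans (∫L-addL (scaleLP ((c , mono a b []) ∷ []) (plethMono 0 α)) (pleth f) w φ)
      (cong₂ _+_ (trans (∫L-scaleLP ((c , mono a b []) ∷ []) (plethMono 0 α) w φ) (QP.+-identityʳ (c * ∫L (plethMono 0 α) w (λ v b₁ → φ v (mono a b [] · b₁))))) (∫L-pleth f w φ))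

  Dᵀ : ℤ → (Mono → ℚ) → Mono → ℚ
  Dᵀ k ψ μ = ∫L (plethMono 0 (pe μ)) 0 (λ v ν → Hweight k ψ v (qtPart μ · ν))

  ∫-Dpoly : ∀ k f ψ → ∫ (Dpoly k f) ψ ≡ ∫ f (Dᵀ k ψ)
  ∫-Dpoly k f ψ = trans (∫-Dpoly-∫L k f ψ) (∫L-pleth f 0 (Hweight k ψ))


module RaisingIdentity where

  open import Data.Nat as ℕ using (ℕ; suc)
  import Data.Nat.Properties as NP
  import Data.Integer as ℤ
  import Data.Integer.Properties as ZP
  open import Data.Rational as ℚ using (ℚ; _+_)
  open import Data.List using ([]; _∷_; _++_; replicate)
  open import Relation.Binary.PropositionalEquality
  open import Defs
  open FormalSum
  open Monomials
  open LaurentSum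
  open PlethysticShift
  open Transpose


  Hweight-wellDefined : ∀ k ψ → WellDefined ψ → ∀ v → WellDefined (Hweight k ψ v)
  Hweight-wellDefined k ψ r v ν ν' e = ∫-ext (Hℤ (k ℤ.+ ℤ.+ v)) (λ a → r _ _ (·-congʳ a ν ν' e))

  Hweight-wellDefinedL : ∀ k ψ → WellDefined ψ → ∀ q → WellDefinedL (λ v ν → Hweight k ψ v (q · ν))
  Hweight-wellDefinedL k ψ r q v ν ν' e = Hweight-wellDefined k ψ r v _ _ (·-congʳ q ν ν' e)

  -- The plethysm turns the factor p_(i+1) of a monomial into p_(i+1) + M_(i+1) z^(-(i+1)),
  -- and the power z^(-(i+1)) raises the index of the H-coefficient paired with it by i+1.
  Dᵀ-pMono· : ∀ k i ψ → WellDefined ψ → ∀ μ →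
    Dᵀ k ψ (pMono i · μ) ≡ Dᵀ k (λ b → ψ (pMono i · b)) μ + ∫ (emb (Mj (suc i))) (λ a → Dᵀ (k ℤ.+ ℤ.+ suc i) (λ b → ψ (a · b)) μ)
  Dᵀ-pMono· k i ψ r μ = begin
      ∫L (plethMono 0 (addExp (unitExp i) α)) 0 φ
    ≡⟨ plethMono-unitExp i 0 α 0 φ (Hweight-wellDefinedL k ψ r q) ⟩
      ∫L (mulL (pShift (i ℕ.+ 0)) P) 0 φ
    ≡⟨ cong (λ n → ∫L (mulL (pShift n) P) 0 φ) (NP.+-identityʳ i) ⟩
      ∫L (mulL (pShift i) P) 0 φ
    ≡⟨ ∫L-mulL (pShift i) P 0 φ ⟩
      ∫ (p (suc i)) (χ₁ 0) + ∫L (replicate i [] ++ (E ∷ [])) 1 χ₁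
    ≡⟨ cong₂ _+_ (∫-p i (χ₁ 0)) (∫L-single i E 1 χ₁) ⟩
      χ₁ 0 (pMono i) + ∫ E (χ₁ (i ℕ.+ 1))
    ≡⟨ cong₂ _+_ first (∫-ext E second) ⟩
      Dᵀ k (λ b → ψ (pMono i · b)) μ + ∫ E (λ a → Dᵀ (k ℤ.+ ℤ.+ suc i) (λ b → ψ (a · b)) μ) ∎
    where
    open ≡-Reasoning
    α = pe μ
    q = qtPart μ
    P = plethMono 0 α
    E = emb (Mj (suc i))
    φ : ℕ → Mono → ℚ
    φ v ν = Hweight k ψ v (q · ν)
    χ₁ : ℕ → Mono → ℚ
    χ₁ v a = ∫L P v (λ u b → φ u (a · b))
    first : χ₁ 0 (pMono i) ≡ Dᵀ k (λ b → ψ (pMono i · b)) μ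
    first = ∫L-ext P 0 (λ u b → ∫-ext (Hℤ (k ℤ.+ ℤ.+ u)) (λ a → resp≃ r
              (≃trans (≃congʳ a (≃swap q (pMono i) b)) (≃swap a (pMono i) (q · b)))))
    second : ∀ a → χ₁ (i ℕ.+ 1) a ≡ Dᵀ (k ℤ.+ ℤ.+ suc i) (λ b → ψ (a · b)) μ
    second a = trans (∫L-offset P (i ℕ.+ 1) _) (∫L-ext P 0 (λ v b →
       trans (cong (λ z → ∫ (Hℤ z) (λ c → ψ (c · (q · (a · b))))) zeq)
         (∫-ext (Hℤ ((k ℤ.+ ℤ.+ suc i) ℤ.+ ℤ.+ v)) (λ c → resp≃ r
            (≃trans (≃congʳ c (≃swap q a b)) (≃swap c a (q · b)))))))
      where
      zeq : ∀ {v} → k ℤ.+ ℤ.+ (i ℕ.+ 1 ℕ.+ v) ≡ (k ℤ.+ ℤ.+ suc i) ℤ.+ ℤ.+ v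
      zeq {v} = trans (cong (λ n → k ℤ.+ ℤ.+ (n ℕ.+ v)) (NP.+-comm i 1)) (sym (ZP.+-assoc k (ℤ.+ suc i) (ℤ.+ v)))

  Dpoly-p* : ∀ k i F → Dpoly k (p (suc i) *P F) ≈ ((p (suc i) *P Dpoly k F) ++ (emb (Mj (suc i)) *P Dpoly (k ℤ.+ ℤ.+ suc i) F))
  Dpoly-p* k i F ψ r = begin
      ∫ (Dpoly k (p (suc i) *P F)) ψ
    ≡⟨ trans (∫-Dpoly k (p (suc i) *P F) ψ) (∫-p*P i F (Dᵀ k ψ)) ⟩
      ∫ F (λ μ → Dᵀ k ψ (pMono i · μ))
    ≡⟨ trans (∫-ext F (Dᵀ-pMono· k i ψ r)) (∫-+ F _ _) ⟩
      ∫ F (Dᵀ k (λ b → ψ (pMono i · b))) + ∫ F (λ μ → ∫ E (λ a → Dᵀ k' (λ b → ψ (a · b)) μ))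
    ≡⟨ cong₂ _+_ (trans (sym (∫-Dpoly k F (λ b → ψ (pMono i · b)))) (sym (∫-p*P i (Dpoly k F) ψ)))
                 (trans (∫-swap F E (λ μ a → Dᵀ k' (λ b → ψ (a · b)) μ)) (trans (∫-ext E (λ a → sym (∫-Dpoly k' F (λ b → ψ (a · b))))) (sym (∫-*P E (Dpoly k' F) ψ)))) ⟩
      ∫ (p (suc i) *P Dpoly k F) ψ + ∫ (E *P Dpoly k' F) ψ
    ≡⟨ sym (∫-++ (p (suc i) *P Dpoly k F) _ ψ) ⟩
      ∫ ((p (suc i) *P Dpoly k F) ++ (E *P Dpoly k' F)) ψ ∎
    where
    open ≡-Reasoning
    E = emb (Mj (suc i))
    k' = k ℤ.+ ℤ.+ suc i


module RaisingOperator where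

  open import Data.Nat as ℕ using (ℕ; suc)
  open import Data.Integer as ℤ using (ℤ)
  open import Data.List using (_++_)
  open import Defs
  open Monomials
  open PolynomialRing
  open PolySolver using (solve; _:+_; _:*_; :-_; _:=_)
  open RaisingIdentity
  open ≋-Reasoning

  D-raise : (k : ℤ) (i : ℕ) (f : Λ) → D (k ℤ.+ ℤ.+ suc i) f ≈Λ (D k (pxMMul (suc i) f) -Λ pxMMul (suc i) (D k f))
  D-raise k i (F /Λ d) = ≈⇒≈P {X *P emb ((d *QT Mj j) *QT (d *QT Mj j))} {((A *P DM) ++ (negP B *P DM)) *P E} (un≋ goal)
    where
    j = suc i
    X = Dpoly (k ℤ.+ ℤ.+ j) F
    A = Dpoly k (p j *P F)
    B = p j *P Dpoly k F
    E = emb d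
    Mm = emb (Mj j)
    DM = emb (d *QT Mj j)
    D-pF : A ≋ (B ++ (Mm *P X))
    D-pF = ≋i (Dpoly-p* k i F)
    Mj-den : DM ≋ (E *P Mm)
    Mj-den = emb-*QT d (Mj j)
    goal : (X *P emb ((d *QT Mj j) *QT (d *QT Mj j))) ≋ (((A *P DM) ++ (negP B *P DM)) *P E)
    goal = begin
        X *P emb ((d *QT Mj j) *QT (d *QT Mj j))
      ≈⟨ ≋* (≋refl {X}) (≋trans (emb-*QT (d *QT Mj j) (d *QT Mj j)) (≋* Mj-den Mj-den)) ⟩
        X *P ((E *P Mm) *P (E *P Mm))
      ≈⟨ solve 4 (λ X B E M → X :* ((E :* M) :* (E :* M)) := ((B :+ M :* X) :* (E :* M) :+ (:- B) :* (E :* M)) :* E) ≋refl X B E Mm ⟩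
        (((B ++ (Mm *P X)) *P (E *P Mm)) ++ (negP B *P (E *P Mm))) *P E
      ≈⟨ ≋sym (≋* (≋+ (≋* D-pF Mj-den) (≋* (≋refl {negP B}) Mj-den)) (≋refl {E})) ⟩
        ((A *P DM) ++ (negP B *P DM)) *P E ∎


module NatCast where

  open import Data.Nat as ℕ using (ℕ; zero; suc)
  import Data.Nat.Properties as NP
  import Data.Integer as ℤ
  import Data.Integer.Properties as ZP
  open import Data.Rational as ℚ using (ℚ; 1ℚ; _+_; _*_; mkℚ)
  import Data.Rational.Properties as QP
  import Data.Rational.Unnormalised as U
  import Data.Rational.Unnormalised.Properties as UP
  import Data.Nat.Coprimality as Cop
  open import Relation.Binary.PropositionalEquality
  open import Data.Product using (Σ; _,_)
  open import Data.Rational.Solver using (module +-*-Solver)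
  open +-*-Solver
  open import Defs

  fromℕQ-nf : ∀ n → fromℕQ n ≡ mkℚ (ℤ.+ n) 0 (Cop.sym (Cop.1-coprimeTo n))
  fromℕQ-nf n = QP.normalize-coprime (Cop.sym (Cop.1-coprimeTo n))

  natℚ : ℕ → ℚ
  natℚ n = mkℚ (ℤ.+ n) 0 (Cop.sym (Cop.1-coprimeTo n))

  fromℕQ-+ : ∀ m n → fromℕQ (m ℕ.+ n) ≡ fromℕQ m + fromℕQ n
  fromℕQ-+ m n rewrite fromℕQ-nf (m ℕ.+ n) | fromℕQ-nf m | fromℕQ-nf n =
    QP.toℚᵘ-injective (UP.≃-trans (U.*≡* eqz) (UP.≃-sym (QP.toℚᵘ-homo-+ (natℚ m) (natℚ n))))
    where
    eqz : ℤ.+ (m ℕ.+ n) ℤ.* ℤ.+ 1 ≡ (ℤ.+ m ℤ.* ℤ.+ 1 ℤ.+ ℤ.+ n ℤ.* ℤ.+ 1) ℤ.* ℤ.+ 1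
    eqz = cong (ℤ._* ℤ.+ 1) (sym (cong₂ ℤ._+_ (ZP.*-identityʳ (ℤ.+ m)) (ZP.*-identityʳ (ℤ.+ n))))

  fromℕQ-* : ∀ m n → fromℕQ (m ℕ.* n) ≡ fromℕQ m * fromℕQ n
  fromℕQ-* m n rewrite fromℕQ-nf (m ℕ.* n) | fromℕQ-nf m | fromℕQ-nf n =
    QP.toℚᵘ-injective (UP.≃-trans (U.*≡* eqz) (UP.≃-sym (QP.toℚᵘ-homo-* (natℚ m) (natℚ n))))
    where
    eqz : ℤ.+ (m ℕ.* n) ℤ.* ℤ.+ 1 ≡ (ℤ.+ m ℤ.* ℤ.+ n) ℤ.* ℤ.+ 1
    eqz = cong (ℤ._* ℤ.+ 1) (ZP.pos-* m n)

  recip-nf : ∀ k → recipℕ (suc k) ≡ mkℚ (ℤ.+ 1) k (Cop.1-coprimeTo (suc k))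
  recip-nf k = QP.normalize-coprime (Cop.1-coprimeTo (suc k))

  fromℕQ-recipℕ : ∀ k → fromℕQ (suc k) * recipℕ (suc k) ≡ 1ℚ
  fromℕQ-recipℕ k rewrite fromℕQ-nf (suc k) | recip-nf k = QP.*-inverseʳ (mkℚ (ℤ.+ suc k) 0 (Cop.sym (Cop.1-coprimeTo (suc k))))

  fromℕQ-suc-cancelˡ : ∀ N {x y} → fromℕQ (suc N) * x ≡ fromℕQ (suc N) * y → x ≡ y
  fromℕQ-suc-cancelˡ N {x} {y} e = begin
      x
    ≡⟨ sym (trans (cong (_* x) (trans (QP.*-comm (recipℕ (suc N)) _) (fromℕQ-recipℕ N))) (QP.*-identityˡ x)) ⟩
      recipℕ (suc N) * fromℕQ (suc N) * x
    ≡⟨ trans (QP.*-assoc (recipℕ (suc N)) (fromℕQ (suc N)) x) (trans (cong (recipℕ (suc N) *_) e) (sym (QP.*-assoc (recipℕ (suc N)) (fromℕQ (suc N)) y))) ⟩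
      recipℕ (suc N) * fromℕQ (suc N) * y
    ≡⟨ trans (cong (_* y) (trans (QP.*-comm (recipℕ (suc N)) _) (fromℕQ-recipℕ N))) (QP.*-identityˡ y) ⟩
      y ∎
    where open ≡-Reasoning

  !-suc : ∀ m → Σ ℕ (λ k → m ℕ.! ≡ suc k)
  !-suc m with m ℕ.! | NP.1≤n! m
  ... | suc k | _ = k , refl

  fromℕQ-recipℕ-! : ∀ m → fromℕQ (m ℕ.!) * recipℕ (m ℕ.!) ≡ 1ℚ
  fromℕQ-recipℕ-! m with !-suc m
  ... | k , e rewrite e = fromℕQ-recipℕ k

  signQ² : ∀ n → signQ n * signQ n ≡ 1ℚ
  signQ² zero = refl
  signQ² (suc n) = trans (solve 1 (λ s → (:- s) :* (:- s) := s :* s) refl (signQ n)) (signQ² n)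


module Derivative where

  open import Data.Nat as ℕ using (ℕ; zero; suc)
  open import Data.Rational as ℚ using (ℚ; _+_; _*_)
  import Data.Rational.Properties as QP
  open import Data.List using (List; []; _∷_)
  open import Data.Product using (_,_)
  open import Data.Empty using (⊥-elim)
  open import Relation.Nullary using (yes; no; ¬_)
  open import Relation.Binary.PropositionalEquality
  open import Defs
  open FormalSum
  open Monomials
  open NatCast

  decAt : ℕ → List ℕ → List ℕ
  decAt zero [] = []
  decAt zero (a ∷ as) = ℕ.pred a ∷ as
  decAt (suc i) [] = []
  decAt (suc i) (a ∷ as) = a ∷ decAt i as

  nth-decAt-same : ∀ i α → nth (decAt i α) i ≡ ℕ.pred (nth α i)
  nth-decAt-same zero [] = refl
  nth-decAt-same zero (a ∷ as) = refl
  nth-decAt-same (suc i) [] = refl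
  nth-decAt-same (suc i) (a ∷ as) = nth-decAt-same i as

  nth-decAt-diff : ∀ i t α → ¬ t ≡ i → nth (decAt i α) t ≡ nth α t
  nth-decAt-diff zero zero α ne = ⊥-elim (ne refl)
  nth-decAt-diff zero (suc t) [] ne = refl
  nth-decAt-diff zero (suc t) (a ∷ as) ne = refl
  nth-decAt-diff (suc i) t [] ne = refl
  nth-decAt-diff (suc i) zero (a ∷ as) ne = refl
  nth-decAt-diff (suc i) (suc t) (a ∷ as) ne = nth-decAt-diff i t as (λ e → ne (cong suc e))

  expAt : ℕ → Mono → ℚ
  expAt i μ = fromℕQ (nth (pe μ) i)

  lowerAt : ℕ → Mono → Mono
  lowerAt i μ = mono (qe μ) (te μ) (decAt i (pe μ))

  -- ℕ.pred in decAt leaves a junk value at exponent 0, which the factor expAt i μ = 0 kills.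
  ∂ᵀ : ℕ → (Mono → ℚ) → Mono → ℚ
  ∂ᵀ i ψ μ = expAt i μ * ψ (lowerAt i μ)

  ∂P : ℕ → Poly → Poly
  ∂P i [] = []
  ∂P i ((c , μ) ∷ F) = (c * expAt i μ , lowerAt i μ) ∷ ∂P i F

  ∫-∂P : ∀ i F ψ → ∫ (∂P i F) ψ ≡ ∫ F (∂ᵀ i ψ)
  ∫-∂P i [] ψ = refl
  ∫-∂P i ((c , μ) ∷ F) ψ = cong₂ _+_ (QP.*-assoc c (expAt i μ) (ψ (lowerAt i μ))) (∫-∂P i F ψ)

  nth-decAt-cong : ∀ i α β → (∀ t → nth α t ≡ nth β t) → ∀ t → nth (decAt i α) t ≡ nth (decAt i β) t
  nth-decAt-cong i α β e t with t ℕ.≟ i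
  ... | yes refl = trans (nth-decAt-same i α) (trans (cong ℕ.pred (e i)) (sym (nth-decAt-same i β)))
  ... | no ne = trans (nth-decAt-diff i t α ne) (trans (e t) (sym (nth-decAt-diff i t β ne)))

  lowerAt-≃ : ∀ i {μ μ'} → μ ≃ μ' → lowerAt i μ ≃ lowerAt i μ'
  lowerAt-≃ i {μ} {μ'} (≃i e) = let E = toMEq μ μ' e in
    ≃i (fromMEq (lowerAt i μ) (lowerAt i μ') (meq (MEq.eqq E) (MEq.eqt E) (nth-decAt-cong i (pe μ) (pe μ') (MEq.eqp E))))

  expAt-· : ∀ i a b → expAt i (a · b) ≡ expAt i a + expAt i b
  expAt-· i a b = trans (cong fromℕQ (nth-addExp (pe a) (pe b) i)) (fromℕQ-+ (nth (pe a) i) (nth (pe b) i))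

  lowerAt-·ˡ : ∀ i a b x → nth (pe a) i ≡ suc x → lowerAt i (a · b) ≃ (lowerAt i a · b)
  lowerAt-·ˡ i a b x ex = ≃i (fromMEq (lowerAt i (a · b)) (lowerAt i a · b) (meq refl refl f))
    where
    f : ∀ t → nth (decAt i (addExp (pe a) (pe b))) t ≡ nth (addExp (decAt i (pe a)) (pe b)) t
    f t with t ℕ.≟ i
    ... | yes refl = trans (nth-decAt-same i _) (trans (cong ℕ.pred (nth-addExp (pe a) (pe b) i))
            (trans (cong (λ z → ℕ.pred (z ℕ.+ nth (pe b) i)) ex)
            (trans (cong (ℕ._+ nth (pe b) i) (trans (cong ℕ.pred (sym ex)) (sym (nth-decAt-same i (pe a))))) (sym (nth-addExp (decAt i (pe a)) (pe b) i)))))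
    ... | no ne = trans (nth-decAt-diff i t _ ne) (trans (nth-addExp (pe a) (pe b) t)
            (trans (cong (ℕ._+ nth (pe b) t) (sym (nth-decAt-diff i t (pe a) ne))) (sym (nth-addExp (decAt i (pe a)) (pe b) t))))

  lowerAt-·ʳ : ∀ i a b x → nth (pe b) i ≡ suc x → lowerAt i (a · b) ≃ (a · lowerAt i b)
  lowerAt-·ʳ i a b x ex = ≃trans (lowerAt-≃ i (≃comm a b)) (≃trans (lowerAt-·ˡ i b a x ex) (≃comm (lowerAt i b) a))

  expAt-lowerAt-·ˡ : ∀ i ψ → WellDefined ψ → ∀ a b → expAt i a * ψ (lowerAt i (a · b)) ≡ expAt i a * ψ (lowerAt i a · b)
  expAt-lowerAt-·ˡ i ψ r a b with nth (pe a) i in ex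
  ... | zero = trans (QP.*-zeroˡ (ψ (lowerAt i (a · b)))) (sym (QP.*-zeroˡ (ψ (lowerAt i a · b))))
  ... | suc x = cong (fromℕQ (suc x) *_) (resp≃ r (lowerAt-·ˡ i a b x ex))

  expAt-lowerAt-·ʳ : ∀ i ψ → WellDefined ψ → ∀ a b → expAt i b * ψ (lowerAt i (a · b)) ≡ expAt i b * ψ (a · lowerAt i b)
  expAt-lowerAt-·ʳ i ψ r a b with nth (pe b) i in ex
  ... | zero = trans (QP.*-zeroˡ (ψ (lowerAt i (a · b)))) (sym (QP.*-zeroˡ (ψ (a · lowerAt i b))))
  ... | suc x = cong (fromℕQ (suc x) *_) (resp≃ r (lowerAt-·ʳ i a b x ex))

  ∂ᵀ-Leibniz : ∀ i ψ → WellDefined ψ → ∀ a b → ∂ᵀ i ψ (a · b) ≡ ∂ᵀ i (λ x → ψ (x · b)) a + ∂ᵀ i (λ y → ψ (a · y)) b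
  ∂ᵀ-Leibniz i ψ r a b = trans (cong (_* ψ (lowerAt i (a · b))) (expAt-· i a b))
    (trans (QP.*-distribʳ-+ (ψ (lowerAt i (a · b))) (expAt i a) (expAt i b)) (cong₂ _+_ (expAt-lowerAt-·ˡ i ψ r a b) (expAt-lowerAt-·ʳ i ψ r a b)))


module DerivativeLaurent where

  open import Data.Nat as ℕ using (ℕ; zero; suc)
  import Data.Nat.Properties as NP
  open import Data.Rational as ℚ using (ℚ; 0ℚ; 1ℚ; _+_; _*_)
  import Data.Rational.Properties as QP
  open import Data.List using ([]; _∷_; _++_; replicate)
  open import Data.Product using (_,_)
  open import Relation.Nullary using (yes; no; ¬_)
  open import Relation.Binary.PropositionalEquality
  open import Data.Rational.Solver using (module +-*-Solver)
  open +-*-Solver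
  open import Defs
  open FormalSum
  open Monomials
  open NatCast
  open LaurentSum
  open PlethysticShift
  open Derivative

  ∂ᵀL : ℕ → LPoly → ℕ → (ℕ → Mono → ℚ) → ℚ
  ∂ᵀL i A w Φ = ∫L A w (λ v → ∂ᵀ i (Φ v))

  ∂ᵀL-mulL : ∀ i A B w Φ → WellDefinedL Φ →
    ∂ᵀL i (mulL A B) w Φ ≡ ∂ᵀL i A w (λ v a → ∫L B v (λ u b → Φ u (a · b))) + ∫L A w (λ v a → ∂ᵀL i B v (λ u b → Φ u (a · b)))
  ∂ᵀL-mulL i A B w Φ r = begin
      ∂ᵀL i (mulL A B) w Φ
    ≡⟨ ∫L-mulL A B w _ ⟩
      ∫L A w (λ v a → ∫L B v (λ u b → ∂ᵀ i (Φ u) (a · b)))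
    ≡⟨ ∫L-ext A w (λ v a → trans (∫L-ext B v (λ u b → ∂ᵀ-Leibniz i (Φ u) (r u) a b)) (∫L-+ B v _ _)) ⟩
      ∫L A w (λ v a → ∫L B v (λ u b → ∂ᵀ i (λ x → Φ u (x · b)) a) + ∫L B v (λ u b → ∂ᵀ i (λ y → Φ u (a · y)) b))
    ≡⟨ ∫L-+ A w _ _ ⟩
      ∫L A w (λ v a → ∫L B v (λ u b → ∂ᵀ i (λ x → Φ u (x · b)) a)) + ∫L A w (λ v a → ∫L B v (λ u b → ∂ᵀ i (λ y → Φ u (a · y)) b))
    ≡⟨ cong (_+ ∫L A w (λ v a → ∫L B v (λ u b → ∂ᵀ i (λ y → Φ u (a · y)) b))) (∫L-ext A w (λ v a → ∫L-* B v (expAt i a) _)) ⟩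
      ∂ᵀL i A w (λ v a → ∫L B v (λ u b → Φ u (a · b))) + ∫L A w (λ v a → ∂ᵀL i B v (λ u b → Φ u (a · b))) ∎
    where open ≡-Reasoning

  ∂ᵀL-1L : ∀ i w Φ → ∂ᵀL i 1L w Φ ≡ 0ℚ
  ∂ᵀL-1L i w Φ = solve 1 (λ x → con 1ℚ :* (con 0ℚ :* x) :+ con 0ℚ :+ con 0ℚ := con 0ℚ) refl (Φ w (lowerAt i (mono 0 0 [])))

  ∫-emb-∂ᵀ : ∀ E t ψ → ∫ (emb E) (∂ᵀ t ψ) ≡ 0ℚ
  ∫-emb-∂ᵀ [] t ψ = refl
  ∫-emb-∂ᵀ ((c , a , b) ∷ E) t ψ = trans (cong (c * (0ℚ * ψ (lowerAt t (mono a b []))) +_) (∫-emb-∂ᵀ E t ψ))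
     (solve 2 (λ c x → c :* (con 0ℚ :* x) :+ con 0ℚ := con 0ℚ) refl c (ψ (lowerAt t (mono a b []))))

  δ : ℕ → ℕ → ℚ
  δ t l = expAt t (pMono l)

  δ-same : ∀ l → δ l l ≡ 1ℚ
  δ-same l = cong fromℕQ (nth-unitExp-same l)

  δ-diff : ∀ t l → ¬ t ≡ l → δ t l ≡ 0ℚ
  δ-diff t l ne = cong fromℕQ (nth-unitExp-diff l t ne)

  lowerAt-unitExp : ∀ l → lowerAt l (pMono l) ≃ mono 0 0 []
  lowerAt-unitExp l = ≃i (fromMEq (lowerAt l (pMono l)) (mono 0 0 []) (meq refl refl f))
    where
    f : ∀ s → nth (decAt l (unitExp l)) s ≡ 0
    f s with s ℕ.≟ l
    ... | yes refl = trans (nth-decAt-same l (unitExp l)) (cong ℕ.pred (nth-unitExp-same l))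
    ... | no ne = trans (nth-decAt-diff l s (unitExp l) ne) (nth-unitExp-diff l s ne)

  δ-lowerAt : ∀ t l (φ : Mono → ℚ) → WellDefined φ → δ t l * φ (lowerAt t (pMono l)) ≡ δ t l * φ (mono 0 0 [])
  δ-lowerAt t l φ r with t ℕ.≟ l
  ... | yes refl = cong (δ t t *_) (resp≃ r (lowerAt-unitExp t))
  ... | no ne rewrite δ-diff t l ne = trans (QP.*-zeroˡ (φ (lowerAt t (pMono l)))) (sym (QP.*-zeroˡ (φ (mono 0 0 []))))

  ∫-p-∂ᵀ : ∀ t l φ → WellDefined φ → ∫ (p (suc l)) (∂ᵀ t φ) ≡ δ t l * φ (mono 0 0 [])
  ∫-p-∂ᵀ t l φ r = trans (∫-p l (∂ᵀ t φ)) (δ-lowerAt t l φ r)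

  ∂ᵀL-pShift : ∀ t l w Φ → WellDefinedL Φ → ∂ᵀL t (pShift l) w Φ ≡ δ t l * ∫L 1L w Φ
  ∂ᵀL-pShift t l w Φ r = begin
      ∫ (p (suc l)) (∂ᵀ t (Φ w)) + ∫L (replicate l [] ++ (emb (Mj (suc l)) ∷ [])) (suc w) (λ v → ∂ᵀ t (Φ v))
    ≡⟨ cong₂ _+_ (∫-p-∂ᵀ t l (Φ w) (r w)) (trans (∫L-single l _ (suc w) _) (∫-emb-∂ᵀ (Mj (suc l)) t (Φ (l ℕ.+ suc w)))) ⟩
      δ t l * Φ w (mono 0 0 []) + 0ℚ
    ≡⟨ solve 2 (λ d x → d :* x :+ con 0ℚ := d :* (con 1ℚ :* x :+ con 0ℚ :+ con 0ℚ)) refl (δ t l) (Φ w (mono 0 0 [])) ⟩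
      δ t l * ∫L 1L w Φ ∎
    where open ≡-Reasoning

  ∂ᵀL-powL : ∀ i B d → (∀ w Φ → WellDefinedL Φ → ∂ᵀL i B w Φ ≡ d * ∫L 1L w Φ) →
    ∀ n w Φ → WellDefinedL Φ → ∂ᵀL i (powL B (suc n)) w Φ ≡ fromℕQ (suc n) * d * ∫L (powL B n) w Φ
  ∂ᵀL-powL i B d hB zero w Φ r = begin
      ∂ᵀL i (mulL B 1L) w Φ
    ≡⟨ ∂ᵀL-mulL i B 1L w Φ r ⟩
      ∂ᵀL i B w Φ' + ∫L B w (λ v a → ∂ᵀL i 1L v (λ u b → Φ u (a · b)))
    ≡⟨ cong₂ _+_ (hB w Φ' (wellDefinedL-∫L· 1L Φ r)) (trans (∫L-ext B w (λ v a → ∂ᵀL-1L i v (λ u b → Φ u (a · b)))) (∫L-zero B w)) ⟩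
      d * ∫L 1L w Φ' + 0ℚ
    ≡⟨ cong (λ z → d * z + 0ℚ) (trans (sym (∫L-mulL 1L 1L w Φ)) (mulL-idˡ 1L w Φ r)) ⟩
      d * ∫L 1L w Φ + 0ℚ
    ≡⟨ solve 2 (λ d x → d :* x :+ con 0ℚ := con 1ℚ :* d :* x) refl d (∫L 1L w Φ) ⟩
      fromℕQ 1 * d * ∫L 1L w Φ ∎
    where
    open ≡-Reasoning
    Φ' : ℕ → Mono → ℚ
    Φ' v a = ∫L 1L v (λ u b → Φ u (a · b))
  ∂ᵀL-powL i B d hB (suc n) w Φ r = begin
      ∂ᵀL i (mulL B P) w Φ
    ≡⟨ ∂ᵀL-mulL i B P w Φ r ⟩
      ∂ᵀL i B w Φ' + ∫L B w (λ v a → ∂ᵀL i P v (λ u b → Φ u (a · b)))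
    ≡⟨ cong₂ _+_ (hB w Φ' (wellDefinedL-∫L· P Φ r)) (∫L-ext B w (λ v a → ∂ᵀL-powL i B d hB n v _ (wellDefinedL-·ʳ Φ r a))) ⟩
      d * ∫L 1L w Φ' + ∫L B w (λ v a → fromℕQ (suc n) * d * ∫L (powL B n) v (λ u b → Φ u (a · b)))
    ≡⟨ cong₂ _+_ (cong (d *_) (trans (sym (∫L-mulL 1L P w Φ)) (mulL-idˡ P w Φ r))) (trans (∫L-* B w (fromℕQ (suc n) * d) _) (cong (fromℕQ (suc n) * d *_) (sym (∫L-mulL B (powL B n) w Φ)))) ⟩
      d * ∫L P w Φ + fromℕQ (suc n) * d * ∫L P w Φ
    ≡⟨ solve 3 (λ d x c → d :* x :+ c :* d :* x := (con 1ℚ :+ c) :* d :* x) refl d (∫L P w Φ) (fromℕQ (suc n)) ⟩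
      (1ℚ + fromℕQ (suc n)) * d * ∫L P w Φ
    ≡⟨ cong (λ z → z * d * ∫L P w Φ) (sym (fromℕQ-+ 1 (suc n))) ⟩
      fromℕQ (suc (suc n)) * d * ∫L P w Φ ∎
    where
    open ≡-Reasoning
    P = powL B (suc n)
    Φ' : ℕ → Mono → ℚ
    Φ' v a = ∫L P v (λ u b → Φ u (a · b))

  ∂ᵀL-powL-other : ∀ t l → ¬ t ≡ l → ∀ a w Φ → WellDefinedL Φ → ∂ᵀL t (powL (pShift l) a) w Φ ≡ 0ℚ
  ∂ᵀL-powL-other t l ne zero w Φ r = ∂ᵀL-1L t w Φ
  ∂ᵀL-powL-other t l ne (suc a) w Φ r =
    trans (∂ᵀL-powL t (pShift l) (δ t l) (∂ᵀL-pShift t l) a w Φ r)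
     (trans (cong (λ z → fromℕQ (suc a) * z * ∫L (powL (pShift l) a) w Φ) (δ-diff t l ne))
       (solve 2 (λ c x → c :* con 0ℚ :* x := con 0ℚ) refl (fromℕQ (suc a)) (∫L (powL (pShift l) a) w Φ)))

  ∂ᵀL-plethMono-later : ∀ t s α w Φ → WellDefinedL Φ → ∂ᵀL t (plethMono (suc (s ℕ.+ t)) α) w Φ ≡ 0ℚ
  ∂ᵀL-plethMono-later t s [] w Φ r = ∂ᵀL-1L t w Φ
  ∂ᵀL-plethMono-later t s (a ∷ as) w Φ r =
    trans (∂ᵀL-mulL t (powL (pShift i₀) a) R w Φ r)
     (trans (cong₂ _+_ (∂ᵀL-powL-other t i₀ (NP.m≢1+n+m t) a w _ (wellDefinedL-∫L· R Φ r))
        (trans (∫L-ext (powL (pShift i₀) a) w (λ v x → ∂ᵀL-plethMono-later t (suc s) as v _ (wellDefinedL-·ʳ Φ r x))) (∫L-zero (powL (pShift i₀) a) w)))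
       (QP.+-identityˡ 0ℚ))
    where
    i₀ = suc (s ℕ.+ t)
    R = plethMono (suc i₀) as

  ∂ᵀL-plethMono : ∀ r i₀ α w Φ → WellDefinedL Φ → ∂ᵀL (r ℕ.+ i₀) (plethMono i₀ α) w Φ ≡ fromℕQ (nth α r) * ∫L (plethMono i₀ (decAt r α)) w Φ
  ∂ᵀL-plethMono r i₀ [] w Φ rr = trans (∂ᵀL-1L (r ℕ.+ i₀) w Φ) (sym (QP.*-zeroˡ (∫L (plethMono i₀ (decAt r [])) w Φ)))
  ∂ᵀL-plethMono zero i₀ (zero ∷ as) w Φ rr =
    trans (∂ᵀL-mulL i₀ 1L R w Φ rr)
     (trans (cong₂ _+_ (∂ᵀL-1L i₀ w (λ v a → ∫L R v (λ u b → Φ u (a · b)))) (trans (∫L-ext 1L w (λ v x → ∂ᵀL-plethMono-later i₀ 0 as v _ (wellDefinedL-·ʳ Φ rr x))) (∫L-zero 1L w)))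
       (trans (QP.+-identityˡ 0ℚ) (sym (QP.*-zeroˡ (∫L (plethMono i₀ (decAt 0 (zero ∷ as))) w Φ)))))
    where R = plethMono (suc i₀) as
  ∂ᵀL-plethMono zero i₀ (suc a ∷ as) w Φ rr =
    trans (∂ᵀL-mulL i₀ (powL (pShift i₀) (suc a)) R w Φ rr)
     (trans (cong₂ _+_ (∂ᵀL-powL i₀ (pShift i₀) (δ i₀ i₀) (∂ᵀL-pShift i₀ i₀) a w _ (wellDefinedL-∫L· R Φ rr))
                       (trans (∫L-ext (powL (pShift i₀) (suc a)) w (λ v x → ∂ᵀL-plethMono-later i₀ 0 as v _ (wellDefinedL-·ʳ Φ rr x))) (∫L-zero (powL (pShift i₀) (suc a)) w)))
       (trans (QP.+-identityʳ _)
         (trans (cong (λ z → fromℕQ (suc a) * z * ∫L (powL (pShift i₀) a) w (λ v x → ∫L R v (λ u b → Φ u (x · b)))) (δ-same i₀))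
           (trans (cong (fromℕQ (suc a) * 1ℚ *_) (sym (∫L-mulL (powL (pShift i₀) a) R w Φ)))
             (cong (_* ∫L (plethMono i₀ (a ∷ as)) w Φ) (QP.*-identityʳ (fromℕQ (suc a))))))))
    where R = plethMono (suc i₀) as
  ∂ᵀL-plethMono (suc r) i₀ (a ∷ as) w Φ rr =
    trans (∂ᵀL-mulL (suc r ℕ.+ i₀) P R w Φ rr)
     (trans (cong₂ _+_ (∂ᵀL-powL-other (suc r ℕ.+ i₀) i₀ ne a w _ (wellDefinedL-∫L· R Φ rr))
                       (∫L-ext P w (λ v x → trans (cong (λ n → ∂ᵀL n R v (λ u b → Φ u (x · b))) (sym (NP.+-suc r i₀)))
                                                (∂ᵀL-plethMono r (suc i₀) as v _ (wellDefinedL-·ʳ Φ rr x)))))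
       (trans (QP.+-identityˡ _)
         (trans (∫L-* P w (fromℕQ (nth as r)) _)
           (cong (fromℕQ (nth as r) *_) (sym (∫L-mulL P (plethMono (suc i₀) (decAt r as)) w Φ))))))
    where
    P = powL (pShift i₀) a
    R = plethMono (suc i₀) as
    ne : ¬ suc r ℕ.+ i₀ ≡ i₀
    ne e = NP.m≢1+n+m i₀ (sym e)


module Convolution where

  open import Data.Nat as ℕ using (ℕ; zero; suc; _∸_)
  import Data.Nat.Properties as NP
  open import Data.Rational as ℚ using (ℚ; 0ℚ; _+_; _*_)
  import Data.Rational.Properties as QP
  open import Relation.Nullary using (¬_)
  open import Relation.Binary.PropositionalEquality
  open import Data.Rational.Solver using (module +-*-Solver)
  open +-*-Solver
  open import Defs
  open FormalSum
  open Monomials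
  open NatCast
  open FiniteSum
  open Transpose using (∫-sumP-map)

  conv : ℕ → (ℕ → ℕ → ℚ) → ℚ
  conv n f = Σ< (suc n) (λ a → f a (n ∸ a))

  shift : ℕ → ℕ → (ℕ → ℚ) → ℚ
  shift zero n g = g n
  shift (suc j) zero g = 0ℚ
  shift (suc j) (suc n) g = shift j n g

  shift-ext : ∀ j n {g g'} → (∀ b → g b ≡ g' b) → shift j n g ≡ shift j n g'
  shift-ext zero n e = e n
  shift-ext (suc j) zero e = refl
  shift-ext (suc j) (suc n) e = shift-ext j n e

  shift-+ : ∀ j n g h → shift j n (λ b → g b + h b) ≡ shift j n g + shift j n h
  shift-+ zero n g h = refl
  shift-+ (suc j) zero g h = sym (QP.+-identityˡ 0ℚ)
  shift-+ (suc j) (suc n) g h = shift-+ j n g h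

  shift-* : ∀ j n s g → shift j n (λ b → s * g b) ≡ s * shift j n g
  shift-* zero n s g = refl
  shift-* (suc j) zero s g = sym (QP.*-zeroʳ s)
  shift-* (suc j) (suc n) s g = shift-* j n s g

  delay : (ℕ → ℚ) → ℕ → ℚ
  delay g zero = 0ℚ
  delay g (suc m) = g m

  shift-delay : ∀ j n g → shift (suc j) n g ≡ shift j n (delay g)
  shift-delay zero zero g = refl
  shift-delay zero (suc n) g = refl
  shift-delay (suc j) zero g = refl
  shift-delay (suc j) (suc n) g = shift-delay j n g

  conv-delay : ∀ f n → conv n f ≡ f 0 n + delay (λ m → conv m (λ a b → f (suc a) b)) n
  conv-delay f zero = refl
  conv-delay f (suc n) = refl

  conv-shift : ∀ j n f → conv n (λ a b → shift j b (f a)) ≡ shift j n (λ n' → conv n' f)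
  conv-shift zero n f = refl
  conv-shift (suc j) zero f = QP.+-identityˡ 0ℚ
  conv-shift (suc j) (suc n) f = begin
      shift j n (f 0) + conv n (λ a b → shift (suc j) b (f (suc a)))
    ≡⟨ cong (shift j n (f 0) +_) (conv-shift (suc j) n (λ a → f (suc a))) ⟩
      shift j n (f 0) + shift (suc j) n (λ n' → conv n' (λ a b → f (suc a) b))
    ≡⟨ cong (shift j n (f 0) +_) (shift-delay j n _) ⟩
      shift j n (f 0) + shift j n (delay (λ n' → conv n' (λ a b → f (suc a) b)))
    ≡⟨ sym (shift-+ j n _ _) ⟩
      shift j n (λ n' → f 0 n' + delay (λ m → conv m (λ a b → f (suc a) b)) n')
    ≡⟨ sym (shift-ext j n (conv-delay f)) ⟩
      shift j n (λ n' → conv n' f) ∎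
    where open ≡-Reasoning

  conv-single : ∀ j n f X → (∀ b → f j b ≡ X b) → (∀ a → ¬ a ≡ j → ∀ b → f a b ≡ 0ℚ) → conv n f ≡ shift j n X
  conv-single zero zero f X e z = trans (QP.+-identityʳ _) (e 0)
  conv-single (suc j) zero f X e z = trans (QP.+-identityʳ _) (z 0 (λ ()) 0)
  conv-single zero (suc n) f X e z = trans (cong₂ _+_ (e (suc n)) (trans (Σ<-ext (suc n) (λ a → z (suc a) (λ ()) (n ∸ a))) (Σ<-zero (suc n)))) (QP.+-identityʳ _)
  conv-single (suc j) (suc n) f X e z = trans (cong (_+ conv n (λ a b → f (suc a) b)) (z 0 (λ ()) (suc n)))
     (trans (QP.+-identityˡ _) (conv-single j n (λ a b → f (suc a) b) X e (λ a ne → z (suc a) (λ eq → ne (NP.suc-injective eq)))))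

  conv-zero : ∀ n f → (∀ a b → a ℕ.+ b ≡ n → f a b ≡ 0ℚ) → conv n f ≡ 0ℚ
  conv-zero zero f z = trans (cong (_+ 0ℚ) (z 0 0 refl)) (QP.+-identityˡ 0ℚ)
  conv-zero (suc n) f z = trans (cong₂ _+_ (z 0 (suc n) refl) (conv-zero n (λ a b → f (suc a) b) (λ a b e → z (suc a) b (cong suc e)))) (QP.+-identityˡ 0ℚ)

  shift-zero : ∀ j n → shift j n (λ _ → 0ℚ) ≡ 0ℚ
  shift-zero zero n = refl
  shift-zero (suc j) zero = refl
  shift-zero (suc j) (suc n) = shift-zero j n

  shift-cong : ∀ j n P Q → (∀ b → b ℕ.+ j ≡ n → P b ≡ Q b) → shift j n P ≡ shift j n Q
  shift-cong zero n P Q h = h n (NP.+-identityʳ n)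
  shift-cong (suc j) zero P Q h = refl
  shift-cong (suc j) (suc n) P Q h = shift-cong j n P Q (λ b e → h b (trans (NP.+-suc b j) (cong suc e)))

  shift-Σ< : ∀ j n K (g : ℕ → ℕ → ℚ) → shift j n (λ b → Σ< K (λ m → g m b)) ≡ Σ< K (λ m → shift j n (g m))
  shift-Σ< j n zero g = shift-zero j n
  shift-Σ< j n (suc K) g = trans (shift-+ j n _ _) (cong (shift j n (g 0) +_) (shift-Σ< j n K (λ m → g (suc m))))

  conv-+ : ∀ n f g → conv n (λ a b → f a b + g a b) ≡ conv n f + conv n g
  conv-+ n f g = Σ<-+ (suc n) (λ a → f a (n ∸ a)) (λ a → g a (n ∸ a))

  conv-* : ∀ n s f → conv n (λ a b → s * f a b) ≡ s * conv n f
  conv-* n s f = Σ<-* (suc n) s (λ a → f a (n ∸ a))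

  conv-ext : ∀ n {f g} → (∀ a b → f a b ≡ g a b) → conv n f ≡ conv n g
  conv-ext n e = Σ<-ext (suc n) (λ a → e a (n ∸ a))

  ∫-shift : ∀ f j b (h : Mono → ℕ → ℚ) → ∫ f (λ x → shift j b (h x)) ≡ shift j b (λ b' → ∫ f (λ x → h x b'))
  ∫-shift f zero b h = refl
  ∫-shift f (suc j) zero h = ∫-zero f
  ∫-shift f (suc j) (suc b) h = ∫-shift f j b h

  ∫-mulS : ∀ A B n ψ → ∫ (mulS A B n) ψ ≡ conv n (λ a b → ∫ (A a) (λ x → ∫ (B b) (λ y → ψ (x · y))))
  ∫-mulS A B n ψ = trans (∫-sumP-map (λ i → A i *P B (n ∸ i)) (λ x → x) (suc n) ψ) (Σ<-ext (suc n) (λ a → ∫-*P (A a) (B (n ∸ a)) ψ))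


module ExponentialSeries where

  open import Data.Nat as ℕ using (ℕ; zero; suc)
  import Data.Nat.Properties as NP
  open import Data.Rational as ℚ using (ℚ; 0ℚ; 1ℚ; _+_; _*_)
  import Data.Rational.Properties as QP
  open import Relation.Nullary using (¬_)
  open import Relation.Binary.PropositionalEquality
  open import Data.Rational.Solver using (module +-*-Solver)
  open +-*-Solver
  open import Defs
  open FormalSum
  open Monomials
  open NatCast
  open FiniteSum
  open Transpose using (Hℤ; ∫-sumP-map)
  open import Data.Integer as ℤ using (-[1+_])
  import Data.Integer.Properties as ZP
  open Derivative
  open DerivativeLaurent using (δ; δ-same; δ-diff; ∫-p-∂ᵀ)
  open Convolution

  ∂ᵀ-Fser-same : ∀ i φ → WellDefined φ → fromℕQ (suc i) * ∫ (Fser (suc i)) (∂ᵀ i φ) ≡ signQ (suc i) * φ ε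
  ∂ᵀ-Fser-same i φ r = begin
      j * ∫ (Fser (suc i)) (∂ᵀ i φ)
    ≡⟨ cong (j *_) (trans (∫-scaleP (signQ (suc i) * recipℕ (suc i)) (p (suc i)) (∂ᵀ i φ)) (cong (signQ (suc i) * recipℕ (suc i) *_) (trans (∫-p-∂ᵀ i i φ r) (cong (_* φ ε) (δ-same i))))) ⟩
      j * (signQ (suc i) * recipℕ (suc i) * (1ℚ * φ ε))
    ≡⟨ solve 4 (λ a s r x → a :* (s :* r :* (con 1ℚ :* x)) := (a :* r) :* (s :* x)) refl j (signQ (suc i)) (recipℕ (suc i)) (φ ε) ⟩
      (j * recipℕ (suc i)) * (signQ (suc i) * φ ε)
    ≡⟨ trans (cong (_* (signQ (suc i) * φ ε)) (fromℕQ-recipℕ i)) (QP.*-identityˡ _) ⟩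
      signQ (suc i) * φ ε ∎
    where
    open ≡-Reasoning
    j = fromℕQ (suc i)

  ∂ᵀ-Fser-other : ∀ i a φ → WellDefined φ → ¬ a ≡ suc i → fromℕQ (suc i) * ∫ (Fser a) (∂ᵀ i φ) ≡ 0ℚ
  ∂ᵀ-Fser-other i zero φ r ne = QP.*-zeroʳ (fromℕQ (suc i))
  ∂ᵀ-Fser-other i (suc l) φ r ne = begin
      j * ∫ (Fser (suc l)) (∂ᵀ i φ)
    ≡⟨ cong (j *_) (trans (∫-scaleP (signQ (suc l) * recipℕ (suc l)) (p (suc l)) (∂ᵀ i φ)) (cong (signQ (suc l) * recipℕ (suc l) *_) (trans (∫-p-∂ᵀ i l φ r) (cong (_* φ ε) (δ-diff i l (λ e → ne (cong suc (sym e)))))))) ⟩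
      j * (signQ (suc l) * recipℕ (suc l) * (0ℚ * φ ε))
    ≡⟨ solve 4 (λ a s r x → a :* (s :* r :* (con 0ℚ :* x)) := con 0ℚ) refl j (signQ (suc l)) (recipℕ (suc l)) (φ ε) ⟩
      0ℚ ∎
    where
    open ≡-Reasoning
    j = fromℕQ (suc i)

  ∫-∂ᵀ-Leibniz : ∀ i f g χ → WellDefined χ → ∫ f (λ x → ∫ g (λ y → ∂ᵀ i χ (x · y))) ≡
            ∫ f (∂ᵀ i (λ x → ∫ g (λ y → χ (x · y)))) + ∫ f (λ x → ∫ g (∂ᵀ i (λ y → χ (x · y))))
  ∫-∂ᵀ-Leibniz i f g χ r = trans (∫-ext f (λ x → trans (∫-ext g (λ y → ∂ᵀ-Leibniz i χ r x y)) (trans (∫-+ g _ _) (cong (_+ ∫ g (∂ᵀ i (λ y → χ (x · y)))) (∫-* g (expAt i x) _)))))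
                     (∫-+ f _ _)

  ∫-powS-zero-∂ᵀ : ∀ i b ψ → ∫ (powS Fser 0 b) (∂ᵀ i ψ) ≡ 0ℚ
  ∫-powS-zero-∂ᵀ i zero ψ = solve 1 (λ x → con 1ℚ :* (con 0ℚ :* x) :+ con 0ℚ := con 0ℚ) refl (ψ (lowerAt i ε))
  ∫-powS-zero-∂ᵀ i (suc b) ψ = refl

  ∂ᵀ-on-Fser-factor : ∀ i n (G : Series) χ → WellDefined χ →
    fromℕQ (suc i) * conv n (λ a b → ∫ (Fser a) (∂ᵀ i (λ x → ∫ (G b) (λ y → χ (x · y))))) ≡
    signQ (suc i) * shift (suc i) n (λ b → ∫ (G b) χ)
  ∂ᵀ-on-Fser-factor i n G χ r = begin
      j * conv n f
    ≡⟨ sym (conv-* n j f) ⟩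
      conv n (λ a b → j * f a b)
    ≡⟨ conv-single (suc i) n (λ a b → j * f a b) (λ b → signQ (suc i) * ∫ (G b) χ)
         (λ b → ∂ᵀ-Fser-same i _ (wellDefined-∫· (G b) χ r)) (λ a ne b → ∂ᵀ-Fser-other i a _ (wellDefined-∫· (G b) χ r) ne) ⟩
      shift (suc i) n (λ b → signQ (suc i) * ∫ (G b) χ)
    ≡⟨ shift-* (suc i) n (signQ (suc i)) (λ b → ∫ (G b) χ) ⟩
      signQ (suc i) * shift (suc i) n (λ b → ∫ (G b) χ) ∎
    where
    open ≡-Reasoning
    j = fromℕQ (suc i)
    f : ℕ → ℕ → ℚ
    f a b = ∫ (Fser a) (∂ᵀ i (λ x → ∫ (G b) (λ y → χ (x · y))))

  -- (i+1) ∂/∂p_(i+1) F^(m+1) = (m+1) (-1)^(i+1) z^(i+1) F^m, by Leibniz and induction on m.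
  mutual
    ∂ᵀ-powS : ∀ i m n χ → WellDefined χ → fromℕQ (suc i) * ∫ (powS Fser (suc m) n) (∂ᵀ i χ) ≡
              fromℕQ (suc m) * signQ (suc i) * shift (suc i) n (λ b → ∫ (powS Fser m b) χ)
    ∂ᵀ-powS i m n χ r = begin
        j * ∫ (powS Fser (suc m) n) (∂ᵀ i χ)
      ≡⟨ cong (j *_) (trans (∫-mulS Fser G n (∂ᵀ i χ)) (conv-ext n (λ a b → ∫-∂ᵀ-Leibniz i (Fser a) (G b) χ r))) ⟩
        j * conv n (λ a b → f₁ a b + f₂ a b)
      ≡⟨ trans (cong (j *_) (conv-+ n f₁ f₂)) (QP.*-distribˡ-+ j (conv n f₁) (conv n f₂)) ⟩
        j * conv n f₁ + j * conv n f₂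
      ≡⟨ cong₂ _+_ (∂ᵀ-on-Fser-factor i n G χ r) (∂ᵀ-on-powS-factor i m n χ r) ⟩
        signQ (suc i) * X + fromℕQ m * signQ (suc i) * X
      ≡⟨ solve 3 (λ s x c → s :* x :+ c :* s :* x := (con 1ℚ :+ c) :* s :* x) refl (signQ (suc i)) X (fromℕQ m) ⟩
        (1ℚ + fromℕQ m) * signQ (suc i) * X
      ≡⟨ cong (λ z → z * signQ (suc i) * X) (sym (fromℕQ-+ 1 m)) ⟩
        fromℕQ (suc m) * signQ (suc i) * X ∎
      where
      open ≡-Reasoning
      j = fromℕQ (suc i)
      G = powS Fser m
      X = shift (suc i) n (λ b → ∫ (G b) χ)
      f₁ f₂ : ℕ → ℕ → ℚ
      f₁ a b = ∫ (Fser a) (∂ᵀ i (λ x → ∫ (G b) (λ y → χ (x · y))))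
      f₂ a b = ∫ (Fser a) (λ x → ∫ (G b) (∂ᵀ i (λ y → χ (x · y))))

    ∂ᵀ-on-powS-factor : ∀ i m n χ → WellDefined χ →
      fromℕQ (suc i) * conv n (λ a b → ∫ (Fser a) (λ x → ∫ (powS Fser m b) (∂ᵀ i (λ y → χ (x · y))))) ≡
      fromℕQ m * signQ (suc i) * shift (suc i) n (λ b → ∫ (powS Fser m b) χ)
    ∂ᵀ-on-powS-factor i zero n χ r = begin
        j * conv n (λ a b → ∫ (Fser a) (λ x → ∫ (powS Fser 0 b) (∂ᵀ i (λ y → χ (x · y)))))
      ≡⟨ cong (j *_) (trans (conv-ext n (λ a b → trans (∫-ext (Fser a) (λ x → ∫-powS-zero-∂ᵀ i b (λ y → χ (x · y)))) (∫-zero (Fser a)))) (Σ<-zero (suc n))) ⟩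
        j * 0ℚ
      ≡⟨ solve 3 (λ j s x → j :* con 0ℚ := con 0ℚ :* s :* x) refl j (signQ (suc i)) (shift (suc i) n (λ b → ∫ (powS Fser 0 b) χ)) ⟩
        0ℚ * signQ (suc i) * shift (suc i) n (λ b → ∫ (powS Fser 0 b) χ) ∎
      where
      open ≡-Reasoning
      j = fromℕQ (suc i)
    ∂ᵀ-on-powS-factor i (suc m) n χ r = begin
        j * conv n (λ a b → ∫ (Fser a) (λ x → ∫ (powS Fser (suc m) b) (∂ᵀ i (λ y → χ (x · y)))))
      ≡⟨ sym (conv-* n j (λ a b → ∫ (Fser a) (λ x → ∫ (powS Fser (suc m) b) (∂ᵀ i (λ y → χ (x · y)))))) ⟩
        conv n (λ a b → j * ∫ (Fser a) (λ x → ∫ (powS Fser (suc m) b) (∂ᵀ i (λ y → χ (x · y)))))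
      ≡⟨ conv-ext n (λ a b → trans (sym (∫-* (Fser a) j _)) (∫-ext (Fser a) (λ x → ∂ᵀ-powS i m b _ (wellDefined-·ʳ x χ r)))) ⟩
        conv n (λ a b → ∫ (Fser a) (λ x → c * shift (suc i) b (λ b' → ∫ (powS Fser m b') (λ y → χ (x · y)))))
      ≡⟨ conv-ext n (λ a b → trans (∫-* (Fser a) c _) (cong (c *_) (∫-shift (Fser a) (suc i) b (λ x b' → ∫ (powS Fser m b') (λ y → χ (x · y)))))) ⟩
        conv n (λ a b → c * shift (suc i) b (T a))
      ≡⟨ trans (conv-* n c (λ a b → shift (suc i) b (T a))) (cong (c *_) (conv-shift (suc i) n T)) ⟩
        c * shift (suc i) n (λ n' → conv n' T)
      ≡⟨ cong (c *_) (shift-ext (suc i) n (λ n' → sym (∫-mulS Fser (powS Fser m) n' χ))) ⟩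
        c * shift (suc i) n (λ b → ∫ (powS Fser (suc m) b) χ) ∎
      where
      open ≡-Reasoning
      j = fromℕQ (suc i)
      c = fromℕQ (suc m) * signQ (suc i)
      T : ℕ → ℕ → ℚ
      T a b' = ∫ (Fser a) (λ x → ∫ (powS Fser m b') (λ y → χ (x · y)))

  ∫-Hc : ∀ n χ → ∫ (Hc n) χ ≡ Σ< (suc n) (λ m → recipℕ (m ℕ.!) * ∫ (powS Fser m n) χ)
  ∫-Hc n χ = trans (∫-sumP-map (λ m → scaleP (recipℕ (m ℕ.!)) (powS Fser m n)) (λ x → x) (suc n) χ)
                   (Σ<-ext (suc n) (λ m → ∫-scaleP (recipℕ (m ℕ.!)) (powS Fser m n) χ))

  powS-Fser-below : ∀ m N → N ℕ.< m → ∀ χ → ∫ (powS Fser m N) χ ≡ 0ℚ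
  powS-Fser-below zero N () χ
  powS-Fser-below (suc m) N lt χ = trans (∫-mulS Fser (powS Fser m) N χ) (conv-zero N _ z)
    where
    z : ∀ a b → a ℕ.+ b ≡ N → ∫ (Fser a) (λ x → ∫ (powS Fser m b) (λ y → χ (x · y))) ≡ 0ℚ
    z zero b e = refl
    z (suc a) b e = trans (∫-ext (Fser (suc a)) (λ x → powS-Fser-below m b blt (λ y → χ (x · y)))) (∫-zero (Fser (suc a)))
      where
      blt : b ℕ.< m
      blt = NP.≤-trans (ℕ.s≤s (NP.m≤n+m b a)) (NP.≤-pred (subst (ℕ._< suc m) (sym e) lt))

  recipℕ-!-suc : ∀ m → recipℕ ((suc m) ℕ.!) * fromℕQ (suc m) ≡ recipℕ (m ℕ.!)
  recipℕ-!-suc m = begin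
      A * a
    ≡⟨ solve 2 (λ A a → A :* a := A :* a :* con 1ℚ) refl A a ⟩
      A * a * 1ℚ
    ≡⟨ cong (A * a *_) (sym (fromℕQ-recipℕ-! m)) ⟩
      A * a * (b * B)
    ≡⟨ solve 4 (λ A a b B → A :* a :* (b :* B) := (a :* b :* A) :* B) refl A a b B ⟩
      (a * b * A) * B
    ≡⟨ cong (λ z → z * A * B) (sym (fromℕQ-* (suc m) (m ℕ.!))) ⟩
      (fromℕQ ((suc m) ℕ.!) * A) * B
    ≡⟨ cong (_* B) (fromℕQ-recipℕ-! (suc m)) ⟩
      1ℚ * B
    ≡⟨ QP.*-identityˡ B ⟩
      B ∎
    where
    open ≡-Reasoning
    A = recipℕ ((suc m) ℕ.!)
    a = fromℕQ (suc m)
    b = fromℕQ (m ℕ.!)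
    B = recipℕ (m ℕ.!)

  ∂ᵀ-Hc-term : ∀ i m n χ → WellDefined χ →
    fromℕQ (suc i) * (recipℕ ((suc m) ℕ.!) * ∫ (powS Fser (suc m) n) (∂ᵀ i χ)) ≡
    signQ (suc i) * shift (suc i) n (λ b → recipℕ (m ℕ.!) * ∫ (powS Fser m b) χ)
  ∂ᵀ-Hc-term i m n χ r = begin
      j * (R * ∫ (powS Fser (suc m) n) (∂ᵀ i χ))
    ≡⟨ solve 3 (λ j R X → j :* (R :* X) := R :* (j :* X)) refl j R (∫ (powS Fser (suc m) n) (∂ᵀ i χ)) ⟩
      R * (j * ∫ (powS Fser (suc m) n) (∂ᵀ i χ))
    ≡⟨ cong (R *_) (∂ᵀ-powS i m n χ r) ⟩
      R * (fromℕQ (suc m) * signQ (suc i) * X)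
    ≡⟨ solve 4 (λ R a s X → R :* (a :* s :* X) := (R :* a) :* (s :* X)) refl R (fromℕQ (suc m)) (signQ (suc i)) X ⟩
      (R * fromℕQ (suc m)) * (signQ (suc i) * X)
    ≡⟨ cong (_* (signQ (suc i) * X)) (recipℕ-!-suc m) ⟩
      recipℕ (m ℕ.!) * (signQ (suc i) * X)
    ≡⟨ solve 3 (λ R s X → R :* (s :* X) := s :* (R :* X)) refl (recipℕ (m ℕ.!)) (signQ (suc i)) X ⟩
      signQ (suc i) * (recipℕ (m ℕ.!) * X)
    ≡⟨ cong (signQ (suc i) *_) (sym (shift-* (suc i) n (recipℕ (m ℕ.!)) _)) ⟩
      signQ (suc i) * shift (suc i) n (λ b → recipℕ (m ℕ.!) * ∫ (powS Fser m b) χ) ∎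
    where
    open ≡-Reasoning
    j = fromℕQ (suc i)
    R = recipℕ ((suc m) ℕ.!)
    X = shift (suc i) n (λ b → ∫ (powS Fser m b) χ)

  ∫-Hc-padded : ∀ b i χ → Σ< (suc b ℕ.+ i) (λ m → recipℕ (m ℕ.!) * ∫ (powS Fser m b) χ) ≡ ∫ (Hc b) χ
  ∫-Hc-padded b i χ = begin
      Σ< (suc b ℕ.+ i) g
    ≡⟨ Σ<-split (suc b) i g ⟩
      Σ< (suc b) g + Σ< i (λ m → g (suc b ℕ.+ m))
    ≡⟨ cong (Σ< (suc b) g +_) (trans (Σ<-ext i beyond) (Σ<-zero i)) ⟩
      Σ< (suc b) g + 0ℚ
    ≡⟨ trans (QP.+-identityʳ _) (sym (∫-Hc b χ)) ⟩
      ∫ (Hc b) χ ∎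
    where
    open ≡-Reasoning
    g : ℕ → ℚ
    g m = recipℕ (m ℕ.!) * ∫ (powS Fser m b) χ
    beyond : ∀ m → g (suc b ℕ.+ m) ≡ 0ℚ
    beyond m = trans (cong (recipℕ ((suc b ℕ.+ m) ℕ.!) *_) (powS-Fser-below (suc b ℕ.+ m) b (ℕ.s≤s (NP.m≤m+n b m)) χ)) (QP.*-zeroʳ (recipℕ ((suc b ℕ.+ m) ℕ.!)))

  ∂ᵀ-Hc : ∀ i n χ → WellDefined χ → fromℕQ (suc i) * ∫ (Hc n) (∂ᵀ i χ) ≡ signQ (suc i) * shift (suc i) n (λ b → ∫ (Hc b) χ)
  ∂ᵀ-Hc i n χ r = begin
      j * ∫ (Hc n) (∂ᵀ i χ)
    ≡⟨ cong (j *_) (∫-Hc n (∂ᵀ i χ)) ⟩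
      j * (recipℕ (0 ℕ.!) * ∫ (powS Fser 0 n) (∂ᵀ i χ) + Σ< n t)
    ≡⟨ cong (λ z → j * (recipℕ (0 ℕ.!) * z + Σ< n t)) (∫-powS-zero-∂ᵀ i n χ) ⟩
      j * (recipℕ (0 ℕ.!) * 0ℚ + Σ< n t)
    ≡⟨ trans (cong (j *_) (trans (cong (_+ Σ< n t) (QP.*-zeroʳ (recipℕ (0 ℕ.!)))) (QP.+-identityˡ _))) (sym (Σ<-* n j t)) ⟩
      Σ< n (λ m → j * t m)
    ≡⟨ trans (Σ<-ext n (λ m → ∂ᵀ-Hc-term i m n χ r)) (Σ<-* n (signQ (suc i)) _) ⟩
      signQ (suc i) * Σ< n (λ m → shift (suc i) n (g m))
    ≡⟨ cong (signQ (suc i) *_) (sym (shift-Σ< (suc i) n n g)) ⟩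
      signQ (suc i) * shift (suc i) n (λ b → Σ< n (λ m → g m b))
    ≡⟨ cong (signQ (suc i) *_) (shift-cong (suc i) n _ _ (λ b e →
         trans (cong (λ z → Σ< z (λ m → g m b)) (trans (sym e) (NP.+-suc b i))) (∫-Hc-padded b i χ))) ⟩
      signQ (suc i) * shift (suc i) n (λ b → ∫ (Hc b) χ) ∎
    where
    open ≡-Reasoning
    j = fromℕQ (suc i)
    t : ℕ → ℚ
    t m = recipℕ ((suc m) ℕ.!) * ∫ (powS Fser (suc m) n) (∂ᵀ i χ)
    g : ℕ → ℕ → ℚ
    g m b = recipℕ (m ℕ.!) * ∫ (powS Fser m b) χ

  shift-Hc : ∀ n j χ → shift (suc j) n (λ b → ∫ (Hc b) χ) ≡ ∫ (Hℤ (ℤ.+ n ℤ.- ℤ.+ suc j)) χ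
  shift-Hc zero j χ = refl
  shift-Hc (suc n) zero χ = refl
  shift-Hc (suc n) (suc j) χ = trans (shift-Hc n j χ) (cong (λ z → ∫ (Hℤ z) χ) (sym (ZP.[1+m]⊖[1+n]≡m⊖n n (suc j))))

  ∂ᵀ-Hℤ : ∀ i z χ → WellDefined χ → fromℕQ (suc i) * ∫ (Hℤ z) (∂ᵀ i χ) ≡ signQ (suc i) * ∫ (Hℤ (z ℤ.- ℤ.+ suc i)) χ
  ∂ᵀ-Hℤ i (ℤ.+ n) χ r = trans (∂ᵀ-Hc i n χ r) (cong (signQ (suc i) *_) (shift-Hc n i χ))
  ∂ᵀ-Hℤ i -[1+ a ] χ r = trans (QP.*-zeroʳ (fromℕQ (suc i))) (sym (QP.*-zeroʳ (signQ (suc i))))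


module LoweringIdentity where

  open import Data.Nat as ℕ using (ℕ; suc)
  import Data.Nat.Properties as NP
  import Data.Integer as ℤ
  open import Data.Rational as ℚ using (ℚ; _+_; _*_)
  import Data.Rational.Properties as QP
  open import Data.List using (_++_)
  open import Relation.Binary.PropositionalEquality
  open import Data.Rational.Solver using (module +-*-Solver)
  open +-*-Solver
  open import Defs
  open FormalSum
  open Monomials
  open NatCast
  open LaurentSum
  open Transpose
  open Derivative
  open DerivativeLaurent
  open ExponentialSeries using (∂ᵀ-Hℤ)
  open RaisingIdentity using (Hweight-wellDefinedL)
  import Data.Integer.Properties as ZP
  open import Algebra.Properties.CommutativeSemigroup ZP.+-commutativeSemigroup using (xy∙z≈xz∙y)

  Hweight-∂ᵀ : ∀ k i ψ → WellDefined ψ → ∀ v μ ν →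
    fromℕQ (suc i) * Hweight k (∂ᵀ i ψ) v (qtPart μ · ν) ≡
    signQ (suc i) * Hweight (k ℤ.- ℤ.+ suc i) ψ v (qtPart μ · ν) + fromℕQ (suc i) * ∂ᵀ i (λ ν' → Hweight k ψ v (qtPart μ · ν')) ν
  Hweight-∂ᵀ k i ψ r v μ ν = begin
      j * ∫ H (λ a → ∂ᵀ i ψ (a · (q · ν)))
    ≡⟨ cong (j *_) (trans (∫-ext H (λ a → ∂ᵀ-Leibniz i ψ r a (q · ν))) (∫-+ H _ _)) ⟩
      j * (∫ H (∂ᵀ i (λ a → ψ (a · (q · ν)))) + ∫ H (λ a → expAt i ν * ψ (a · (q · lowerAt i ν))))
    ≡⟨ QP.*-distribˡ-+ j _ _ ⟩
      j * ∫ H (∂ᵀ i (λ a → ψ (a · (q · ν)))) + j * ∫ H (λ a → expAt i ν * ψ (a · (q · lowerAt i ν)))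
    ≡⟨ cong₂ _+_ (trans (∂ᵀ-Hℤ i (k ℤ.+ ℤ.+ v) _ (λ a a' e → r _ _ (·-congˡ a a' (q · ν) e)))
                        (cong (λ z → signQ (suc i) * ∫ (Hℤ z) (λ a → ψ (a · (q · ν)))) (xy∙z≈xz∙y k (ℤ.+ v) (ℤ.- ℤ.+ suc i))))
                 (cong (j *_) (∫-* H (expAt i ν) _)) ⟩
      signQ (suc i) * Hweight (k ℤ.- ℤ.+ suc i) ψ v (q · ν) + j * ∂ᵀ i (λ ν' → Hweight k ψ v (q · ν')) ν ∎
    where
    open ≡-Reasoning
    j = fromℕQ (suc i)
    q = qtPart μ
    H = Hℤ (k ℤ.+ ℤ.+ v)

  Dᵀ-∂ᵀ : ∀ k i ψ → WellDefined ψ → ∀ μ →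
    fromℕQ (suc i) * Dᵀ k (∂ᵀ i ψ) μ ≡ signQ (suc i) * Dᵀ (k ℤ.- ℤ.+ suc i) ψ μ + fromℕQ (suc i) * ∂ᵀ i (Dᵀ k ψ) μ
  Dᵀ-∂ᵀ k i ψ r μ = begin
      j * ∫L P 0 (λ v ν → Hweight k (∂ᵀ i ψ) v (q · ν))
    ≡⟨ sym (∫L-* P 0 j _) ⟩
      ∫L P 0 (λ v ν → j * Hweight k (∂ᵀ i ψ) v (q · ν))
    ≡⟨ ∫L-ext P 0 (λ v → Hweight-∂ᵀ k i ψ r v μ) ⟩
      ∫L P 0 (λ v ν → signQ (suc i) * Hweight (k ℤ.- ℤ.+ suc i) ψ v (q · ν) + j * ∂ᵀ i (Φ v) ν)
    ≡⟨ trans (∫L-+ P 0 _ _) (cong₂ _+_ (∫L-* P 0 (signQ (suc i)) _) (∫L-* P 0 j _)) ⟩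
      signQ (suc i) * Dᵀ (k ℤ.- ℤ.+ suc i) ψ μ + j * ∂ᵀL i P 0 Φ
    ≡⟨ cong (λ z → signQ (suc i) * Dᵀ (k ℤ.- ℤ.+ suc i) ψ μ + j * z)
         (trans (cong (λ n → ∂ᵀL n P 0 Φ) (sym (NP.+-identityʳ i))) (∂ᵀL-plethMono i 0 (pe μ) 0 Φ (Hweight-wellDefinedL k ψ r q))) ⟩
      signQ (suc i) * Dᵀ (k ℤ.- ℤ.+ suc i) ψ μ + j * ∂ᵀ i (Dᵀ k ψ) μ ∎
    where
    open ≡-Reasoning
    j = fromℕQ (suc i)
    P = plethMono 0 (pe μ)
    q = qtPart μ
    Φ : ℕ → Mono → ℚ
    Φ v ν = Hweight k ψ v (q · ν)

  p⊥ : ℕ → Poly → Poly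
  p⊥ i X = scaleP (fromℕQ (suc i)) (∂P i X)

  ∫-p⊥ : ∀ i X ψ → ∫ (p⊥ i X) ψ ≡ fromℕQ (suc i) * ∫ X (∂ᵀ i ψ)
  ∫-p⊥ i X ψ = trans (∫-scaleP (fromℕQ (suc i)) (∂P i X) ψ) (cong (fromℕQ (suc i) *_) (∫-∂P i X ψ))

  p⊥-Dpoly : ∀ k i F → p⊥ i (Dpoly k F) ≈ (scaleP (signQ (suc i)) (Dpoly (k ℤ.- ℤ.+ suc i) F) ++ Dpoly k (p⊥ i F))
  p⊥-Dpoly k i F ψ r = begin
      ∫ (p⊥ i (Dpoly k F)) ψ
    ≡⟨ ∫-p⊥ i (Dpoly k F) ψ ⟩
      j * ∫ (Dpoly k F) (∂ᵀ i ψ)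
    ≡⟨ cong (j *_) (∫-Dpoly k F (∂ᵀ i ψ)) ⟩
      j * ∫ F (Dᵀ k (∂ᵀ i ψ))
    ≡⟨ sym (∫-* F j _) ⟩
      ∫ F (λ μ → j * Dᵀ k (∂ᵀ i ψ) μ)
    ≡⟨ ∫-ext F (Dᵀ-∂ᵀ k i ψ r) ⟩
      ∫ F (λ μ → signQ (suc i) * Dᵀ (k ℤ.- ℤ.+ suc i) ψ μ + j * ∂ᵀ i (Dᵀ k ψ) μ)
    ≡⟨ trans (∫-+ F _ _) (cong₂ _+_ (∫-* F (signQ (suc i)) _) (∫-* F j _)) ⟩
      signQ (suc i) * ∫ F (Dᵀ (k ℤ.- ℤ.+ suc i) ψ) + j * ∫ F (∂ᵀ i (Dᵀ k ψ))
    ≡⟨ cong₂ _+_ (cong (signQ (suc i) *_) (sym (∫-Dpoly (k ℤ.- ℤ.+ suc i) F ψ))) (trans (sym (∫-p⊥ i F (Dᵀ k ψ))) (sym (∫-Dpoly k (p⊥ i F) ψ))) ⟩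
      signQ (suc i) * ∫ (Dpoly (k ℤ.- ℤ.+ suc i) F) ψ + ∫ (Dpoly k (p⊥ i F)) ψ
    ≡⟨ cong (_+ ∫ (Dpoly k (p⊥ i F)) ψ) (sym (∫-scaleP (signQ (suc i)) (Dpoly (k ℤ.- ℤ.+ suc i) F) ψ)) ⟩
      ∫ (scaleP (signQ (suc i)) (Dpoly (k ℤ.- ℤ.+ suc i) F)) ψ + ∫ (Dpoly k (p⊥ i F)) ψ
    ≡⟨ sym (∫-++ (scaleP (signQ (suc i)) (Dpoly (k ℤ.- ℤ.+ suc i) F)) _ ψ) ⟩
      ∫ (scaleP (signQ (suc i)) (Dpoly (k ℤ.- ℤ.+ suc i) F) ++ Dpoly k (p⊥ i F)) ψ ∎
    where
    open ≡-Reasoning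
    j = fromℕQ (suc i)


module DpolyCongruence where

  open import Data.Nat using (suc)
  import Data.Integer as ℤ
  open import Data.List using ([]; _∷_)
  open import Relation.Binary.PropositionalEquality
  open import Defs
  open FormalSum
  open Monomials
  open LaurentSum
  open PlethysticShift using (addExp-[])
  open Transpose
  open RaisingIdentity using (Hweight-wellDefined)
  open PolynomialRing using (∫-emb-ext)

  plethMono-cong : ∀ i α β → (∀ t → nth α t ≡ nth β t) → plethMono i α ≈L plethMono i β
  plethMono-cong i [] [] e = ≈L-refl {1L}
  plethMono-cong i [] (b ∷ bs) e w φ r = subst (λ b' → ∫L 1L w φ ≡ ∫L (plethMono i (b' ∷ bs)) w φ) (e 0)
    (sym (trans (mulL-idˡ (plethMono (suc i) bs) w φ r) (sym (plethMono-cong (suc i) [] bs (λ t → e (suc t)) w φ r))))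
  plethMono-cong i (a ∷ as) [] e w φ r = subst (λ a' → ∫L (plethMono i (a' ∷ as)) w φ ≡ ∫L 1L w φ) (sym (e 0))
    (trans (mulL-idˡ (plethMono (suc i) as) w φ r) (plethMono-cong (suc i) as [] (λ t → e (suc t)) w φ r))
  plethMono-cong i (a ∷ as) (b ∷ bs) e w φ r = subst (λ b' → ∫L (plethMono i (a ∷ as)) w φ ≡ ∫L (plethMono i (b' ∷ bs)) w φ) (e 0)
    (mulL-cong {powL (pShift i) a} {powL (pShift i) a} {plethMono (suc i) as} {plethMono (suc i) bs} (≈L-refl {powL (pShift i) a}) (plethMono-cong (suc i) as bs (λ t → e (suc t))) w φ r)

  Dᵀ-wellDefined : ∀ k ψ → WellDefined ψ → WellDefined (Dᵀ k ψ)
  Dᵀ-wellDefined k ψ r μ μ' e = trans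
    (plethMono-cong 0 (pe μ) (pe μ') (MEq.eqp E) 0 _ (λ v ν ν' e' → Hweight-wellDefined k ψ r v _ _ (·-congʳ (qtPart μ) ν ν' e')))
    (∫L-ext (plethMono 0 (pe μ')) 0 (λ v ν → resp≃ (Hweight-wellDefined k ψ r v) (≃congˡ ν qq)))
    where
    E = toMEq μ μ' e
    qq : qtPart μ ≃ qtPart μ'
    qq = ≃i (fromMEq (qtPart μ) (qtPart μ') (meq (MEq.eqq E) (MEq.eqt E) (λ t → refl)))

  Dpoly-cong : ∀ k {F G} → F ≈ G → Dpoly k F ≈ Dpoly k G
  Dpoly-cong k {F} {G} e ψ r = trans (∫-Dpoly k F ψ) (trans (e _ (Dᵀ-wellDefined k ψ r)) (sym (∫-Dpoly k G ψ)))

  Dpoly-*emb : ∀ k X e → Dpoly k (X *P emb e) ≈ (Dpoly k X *P emb e)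
  Dpoly-*emb k X e ψ r = begin
      ∫ (Dpoly k (X *P emb e)) ψ
    ≡⟨ trans (∫-Dpoly k (X *P emb e) ψ) (∫-*P X (emb e) (Dᵀ k ψ)) ⟩
      ∫ X (λ μ → ∫ (emb e) (λ β → Dᵀ k ψ (μ · β)))
    ≡⟨ ∫-ext X pt ⟩
      ∫ X (Dᵀ k (λ a → ∫ (emb e) (λ β → ψ (a · β))))
    ≡⟨ sym (trans (∫-Dpoly k X _) refl) ⟩
      ∫ (Dpoly k X) (λ a → ∫ (emb e) (λ β → ψ (a · β)))
    ≡⟨ sym (∫-*P (Dpoly k X) (emb e) ψ) ⟩
      ∫ (Dpoly k X *P emb e) ψ ∎
    where
    open ≡-Reasoning
    pt : ∀ μ → ∫ (emb e) (λ β → Dᵀ k ψ (μ · β)) ≡ Dᵀ k (λ a → ∫ (emb e) (λ β → ψ (a · β))) μ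
    pt μ = begin
        ∫ (emb e) (λ β → Dᵀ k ψ (μ · β))
      ≡⟨ ∫-emb-ext e (λ a b → cong (λ z → ∫L (plethMono 0 z) 0 (λ v ν → Hweight k ψ v ((qtPart μ · mono a b []) · ν))) (addExp-[] (pe μ))) ⟩
        ∫ (emb e) (λ β → ∫L P 0 (λ v ν → ∫ (Hℤ (k ℤ.+ ℤ.+ v)) (λ c → ψ (c · ((qtPart μ · β) · ν)))))
      ≡⟨ ∫-∫L-swap (emb e) P 0 _ ⟩
        ∫L P 0 (λ v ν → ∫ (emb e) (λ β → ∫ (Hℤ (k ℤ.+ ℤ.+ v)) (λ c → ψ (c · ((qtPart μ · β) · ν)))))
      ≡⟨ ∫L-ext P 0 (λ v ν → trans (∫-swap (emb e) (Hℤ (k ℤ.+ ℤ.+ v)) _) (∫-ext (Hℤ (k ℤ.+ ℤ.+ v)) (λ c → ∫-ext (emb e) (λ β → resp≃ r (rearr c β ν))))) ⟩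
        Dᵀ k (λ a → ∫ (emb e) (λ β → ψ (a · β))) μ ∎
      where
      P = plethMono 0 (pe μ)
      rearr : ∀ c β ν → (c · ((qtPart μ · β) · ν)) ≃ ((c · (qtPart μ · ν)) · β)
      rearr c β ν = ≃trans (≃congʳ c (≃trans (≃assoc (qtPart μ) β ν) (≃trans (≃congʳ (qtPart μ) (≃comm β ν)) (≃sym (≃assoc (qtPart μ) ν β)))))
                      (≃sym (≃assoc c (qtPart μ · ν) β))


module ZFactor where

  open import Data.Nat as ℕ using (ℕ; zero; suc; _^_; _!)
  import Data.Nat.Properties as NP
  open import Data.Rational as ℚ using (ℚ; 1ℚ; _*_)
  import Data.Rational.Properties as QP
  open import Data.List using (List; []; _∷_)
  open import Data.Product using (Σ; _,_; proj₁)
  open import Data.Bool using (T)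
  open import Relation.Binary.PropositionalEquality
  open import Data.Rational.Solver using (module +-*-Solver)
  open +-*-Solver
  import Data.Nat.Solver
  module NS = Data.Nat.Solver.+-*-Solver
  open import Defs
  open Monomials using (nth; expEq⇒; nth-addExp)
  open NatCast
  open PlethysticShift using (unitExp; addExp-[])

  -- The helper go of zee is bound in a where clause of Defs, so it can only be extracted as a
  -- function of zee's argument, on which it does not depend (zeeFrom-irrelevant).
  zee-go : Σ (List ℕ → ℕ → List ℕ → ℚ) (λ H → ∀ a as → zee (a ∷ as) ≡ fromℕQ (1 ^ a ℕ.* a !) * H (a ∷ as) 2 as)
  zee-go = H₀ , helper
    where
    H₀ : List ℕ → ℕ → List ℕ → ℚ
    H₀ = _
    helper : ∀ a as → zee (a ∷ as) ≡ fromℕQ (1 ^ a ℕ.* a !) * H₀ (a ∷ as) 2 as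
    helper a as with a ∷ as | 2
    ... | X | k = refl

  zeeFrom : List ℕ → ℕ → List ℕ → ℚ
  zeeFrom = proj₁ zee-go

  zeeFrom-irrelevant : ∀ X Y k l → zeeFrom X k l ≡ zeeFrom Y k l
  zeeFrom-irrelevant X Y k [] = refl
  zeeFrom-irrelevant X Y k (a ∷ as) = cong (fromℕQ (k ^ a ℕ.* a !) *_) (zeeFrom-irrelevant X Y (suc k) as)

  zeeFrom-cong : ∀ X k l l' → (∀ t → nth l t ≡ nth l' t) → zeeFrom X k l ≡ zeeFrom X k l'
  zeeFrom-cong X k [] [] e = refl
  zeeFrom-cong X k [] (b ∷ bs) e = subst (λ b' → 1ℚ ≡ zeeFrom X k (b' ∷ bs)) (e 0)
    (sym (trans (cong (fromℕQ (k ^ 0 ℕ.* 0 !) *_) (sym (zeeFrom-cong X (suc k) [] bs (λ t → e (suc t))))) (QP.*-identityʳ _)))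
  zeeFrom-cong X k (a ∷ as) [] e = subst (λ a' → zeeFrom X k (a' ∷ as) ≡ 1ℚ) (sym (e 0))
    (trans (cong (fromℕQ (k ^ 0 ℕ.* 0 !) *_) (zeeFrom-cong X (suc k) as [] (λ t → e (suc t)))) (QP.*-identityʳ _))
  zeeFrom-cong X k (a ∷ as) (b ∷ bs) e = subst (λ b' → zeeFrom X k (a ∷ as) ≡ zeeFrom X k (b' ∷ bs)) (e 0)
    (cong (fromℕQ (k ^ a ℕ.* a !) *_) (zeeFrom-cong X (suc k) as bs (λ t → e (suc t))))

  zee-cong : ∀ α β → T (expEq α β) → zee α ≡ zee β
  zee-cong α β e = trans (zeeFrom-cong α 1 α β (expEq⇒ α β e)) (zeeFrom-irrelevant α β 1 β)

  zeeFrom-unitExp : ∀ X i k λ' → zeeFrom X k (addExp (unitExp i) λ') ≡ zeeFrom X k λ' * fromℕQ (i ℕ.+ k) * fromℕQ (suc (nth λ' i))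
  zeeFrom-unitExp X zero k [] = begin
      fromℕQ (k ^ 1 ℕ.* 1 !) * 1ℚ
    ≡⟨ cong (λ z → fromℕQ z * 1ℚ) (NS.solve 1 (λ k → (k NS.:* NS.con 1) NS.:* (NS.con 1 NS.:* NS.con 1) NS.:= k) refl k) ⟩
      fromℕQ k * 1ℚ
    ≡⟨ solve 1 (λ x → x :* con 1ℚ := con 1ℚ :* x :* con 1ℚ) refl (fromℕQ k) ⟩
      1ℚ * fromℕQ k * 1ℚ ∎
    where open ≡-Reasoning
  zeeFrom-unitExp X zero k (a ∷ as) = begin
      fromℕQ (k ^ suc a ℕ.* (suc a) !) * zeeFrom X (suc k) as
    ≡⟨ cong (λ z → fromℕQ z * zeeFrom X (suc k) as) ℕeq ⟩
      fromℕQ ((k ^ a ℕ.* a !) ℕ.* (k ℕ.* suc a)) * zeeFrom X (suc k) as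
    ≡⟨ cong (_* zeeFrom X (suc k) as) (trans (fromℕQ-* (k ^ a ℕ.* a !) (k ℕ.* suc a)) (cong (fromℕQ (k ^ a ℕ.* a !) *_) (fromℕQ-* k (suc a)))) ⟩
      fromℕQ (k ^ a ℕ.* a !) * (fromℕQ k * fromℕQ (suc a)) * zeeFrom X (suc k) as
    ≡⟨ solve 4 (λ x k s g → x :* (k :* s) :* g := x :* g :* k :* s) refl (fromℕQ (k ^ a ℕ.* a !)) (fromℕQ k) (fromℕQ (suc a)) (zeeFrom X (suc k) as) ⟩
      fromℕQ (k ^ a ℕ.* a !) * zeeFrom X (suc k) as * fromℕQ k * fromℕQ (suc a) ∎
    where
    open ≡-Reasoning
    ℕeq : k ^ suc a ℕ.* (suc a) ! ≡ (k ^ a ℕ.* a !) ℕ.* (k ℕ.* suc a)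
    ℕeq = NS.solve 4 (λ k p f s → (k NS.:* p) NS.:* (s NS.:* f) NS.:= (p NS.:* f) NS.:* (k NS.:* s)) refl k (k ^ a) (a !) (suc a)
  zeeFrom-unitExp X (suc i) k [] = begin
      fromℕQ (k ^ 0 ℕ.* 0 !) * zeeFrom X (suc k) (unitExp i)
    ≡⟨ cong (λ z → fromℕQ (k ^ 0 ℕ.* 0 !) * zeeFrom X (suc k) z) (sym (addExp-[] (unitExp i))) ⟩
      1ℚ * zeeFrom X (suc k) (addExp (unitExp i) [])
    ≡⟨ cong (1ℚ *_) (zeeFrom-unitExp X i (suc k) []) ⟩
      1ℚ * (1ℚ * fromℕQ (i ℕ.+ suc k) * 1ℚ)
    ≡⟨ cong (λ n → 1ℚ * (1ℚ * fromℕQ n * 1ℚ)) (NP.+-suc i k) ⟩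
      1ℚ * (1ℚ * fromℕQ (suc i ℕ.+ k) * 1ℚ)
    ≡⟨ solve 1 (λ x → con 1ℚ :* (con 1ℚ :* x :* con 1ℚ) := con 1ℚ :* x :* con 1ℚ) refl (fromℕQ (suc i ℕ.+ k)) ⟩
      1ℚ * fromℕQ (suc i ℕ.+ k) * 1ℚ ∎
    where open ≡-Reasoning
  zeeFrom-unitExp X (suc i) k (a ∷ as) = begin
      fromℕQ (k ^ a ℕ.* a !) * zeeFrom X (suc k) (addExp (unitExp i) as)
    ≡⟨ cong (fromℕQ (k ^ a ℕ.* a !) *_) (zeeFrom-unitExp X i (suc k) as) ⟩
      fromℕQ (k ^ a ℕ.* a !) * (zeeFrom X (suc k) as * fromℕQ (i ℕ.+ suc k) * fromℕQ (suc (nth as i)))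
    ≡⟨ cong (λ n → fromℕQ (k ^ a ℕ.* a !) * (zeeFrom X (suc k) as * fromℕQ n * fromℕQ (suc (nth as i)))) (NP.+-suc i k) ⟩
      fromℕQ (k ^ a ℕ.* a !) * (zeeFrom X (suc k) as * fromℕQ (suc i ℕ.+ k) * fromℕQ (suc (nth as i)))
    ≡⟨ solve 4 (λ x g n s → x :* (g :* n :* s) := x :* g :* n :* s) refl (fromℕQ (k ^ a ℕ.* a !)) (zeeFrom X (suc k) as) (fromℕQ (suc i ℕ.+ k)) (fromℕQ (suc (nth as i))) ⟩
      fromℕQ (k ^ a ℕ.* a !) * zeeFrom X (suc k) as * fromℕQ (suc i ℕ.+ k) * fromℕQ (suc (nth as i)) ∎
    where open ≡-Reasoning

  zee-unitExp : ∀ i λ' → zee (addExp (unitExp i) λ') ≡ zee λ' * fromℕQ (suc i) * fromℕQ (suc (nth λ' i))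
  zee-unitExp i λ' = trans (zeeFrom-unitExp (addExp (unitExp i) λ') i 1 λ')
    (cong₂ (λ x n → x * fromℕQ n * fromℕQ (suc (nth λ' i))) (zeeFrom-irrelevant (addExp (unitExp i) λ') λ' 1 λ') (NP.+-comm i 1))

  pos⇒suc : ∀ x → 1 ℕ.≤ x → Σ ℕ (λ N → x ≡ suc N)
  pos⇒suc (suc x) _ = x , refl

  zeeFrom-positive : ∀ X k l → 1 ℕ.≤ k → Σ ℕ (λ N → zeeFrom X k l ≡ fromℕQ (suc N))
  zeeFrom-positive X k [] le = 0 , refl
  zeeFrom-positive X zero (a ∷ as) ()
  zeeFrom-positive X k@(suc k') (a ∷ as) le with zeeFrom-positive X (suc k) as (ℕ.s≤s ℕ.z≤n)
  ... | N , e with pos⇒suc (k ^ a ℕ.* a ! ℕ.* suc N) (NP.*-mono-≤ (NP.*-mono-≤ (NP.m^n>0 k a) (NP.1≤n! a)) (ℕ.s≤s ℕ.z≤n))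
  ...   | M , eq = M , trans (cong (fromℕQ (k ^ a ℕ.* a !) *_) e) (trans (sym (fromℕQ-* (k ^ a ℕ.* a !) (suc N))) (cong fromℕQ eq))

  zee-positive : ∀ α → Σ ℕ (λ N → zee α ≡ fromℕQ (suc N))
  zee-positive α = zeeFrom-positive α 1 α (ℕ.s≤s ℕ.z≤n)


module Adjoint where

  open import Data.Nat as ℕ using (ℕ; zero; suc)
  import Data.Nat.Properties as NP
  open import Data.Rational as ℚ using (ℚ; 0ℚ; 1ℚ; _+_; _*_)
  import Data.Rational.Properties as QP
  open import Data.List using (List; []; _∷_; _++_)
  open import Data.Product using (_,_)
  open import Data.Bool using (Bool; true; false; T; if_then_else_)
  open import Data.Bool.Properties using (T-≡)
  open import Function.Bundles using (Equivalence)
  open import Data.Empty using (⊥; ⊥-elim)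
  open import Data.Unit using (tt)
  open import Relation.Nullary using (yes; no)
  open import Relation.Binary.PropositionalEquality
  open import Data.Rational.Solver using (module +-*-Solver)
  open +-*-Solver
  open import Defs
  open FormalSum
  open Monomials
  open NatCast
  open PlethysticShift using (unitExp; addExp-[]; nth-unitExp-same; nth-unitExp-diff)
  open Transpose using (qtPart)
  open Derivative
  open LoweringIdentity using (p⊥; ∫-p⊥)
  open PolynomialRing using (∫-emb-ext; ∫-emb-++; ∫-emb-*QT)
  open ZFactor

  ind : Bool → ℚ
  ind true = 1ℚ
  ind false = 0ℚ

  ∫At : Poly → List ℕ → (Mono → ℚ) → ℚ
  ∫At X λ' φ = ∫ X (λ μ → ind (expEq (pe μ) λ') * φ (qtPart μ))

  ∫-hallP-single : ∀ X c' a' b' β φ → ∫ (emb (hallP X ((c' , mono a' b' β) ∷ []))) φ ≡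
     ∫ X (λ μ → ind (expEq (pe μ) β) * (c' * zee β) * φ (mono (qe μ ℕ.+ a') (te μ ℕ.+ b') []))
  ∫-hallP-single [] c' a' b' β φ = refl
  ∫-hallP-single ((c , μ) ∷ X) c' a' b' β φ =
    trans (∫-emb-++ ((if expEq (pe μ) β then (c * c' * zee (pe μ) , qe μ ℕ.+ a' , te μ ℕ.+ b') ∷ [] else []) ++ []) (hallP X ((c' , mono a' b' β) ∷ [])) φ) (cong₂ _+_ headEq (∫-hallP-single X c' a' b' β φ))
    where
    headEq : ∫ (emb ((if expEq (pe μ) β then (c * c' * zee (pe μ) , qe μ ℕ.+ a' , te μ ℕ.+ b') ∷ [] else []) ++ [])) φ
             ≡ c * (ind (expEq (pe μ) β) * (c' * zee β) * φ (mono (qe μ ℕ.+ a') (te μ ℕ.+ b') []))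
    headEq with expEq (pe μ) β in eq
    ... | true rewrite zee-cong (pe μ) β (subst T (sym eq) tt) =
          solve 4 (λ c c' z x → c :* c' :* z :* x :+ con 0ℚ := c :* (con 1ℚ :* (c' :* z) :* x)) refl c c' (zee β) (φ (mono (qe μ ℕ.+ a') (te μ ℕ.+ b') []))
    ... | false = solve 3 (λ c y x → con 0ℚ := c :* (con 0ℚ :* y :* x)) refl c (c' * zee β) (φ (mono (qe μ ℕ.+ a') (te μ ℕ.+ b') []))

  coef-∫At : ∀ X a0 b0 λ' → coef X (mono a0 b0 λ') ≡ ∫At X λ' (χ (mono a0 b0 []))
  coef-∫At X a0 b0 λ' = ∫-ext X pχ
    where
    pχ : ∀ μ → χ (mono a0 b0 λ') μ ≡ ind (expEq (pe μ) λ') * χ (mono a0 b0 []) (qtPart μ)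
    pχ μ with qe μ ℕ.≡ᵇ a0 | te μ ℕ.≡ᵇ b0 | expEq (pe μ) λ'
    ... | true | true | true = refl
    ... | true | true | false = refl
    ... | true | false | true = refl
    ... | true | false | false = refl
    ... | false | _ | true = refl
    ... | false | _ | false = refl

  ∫At-*emb : ∀ X d λ' φ → ∫At (X *P emb d) λ' φ ≡ ∫At X λ' (λ m → ∫ (emb d) (λ β → φ (m · β)))
  ∫At-*emb X d λ' φ = trans (∫-*P X (emb d) _) (∫-ext X (λ μ →
    trans (∫-emb-ext d (λ a b → cong (λ z → ind (expEq z λ') * φ (qtPart μ · mono a b [])) (addExp-[] (pe μ))))
          (∫-* (emb d) (ind (expEq (pe μ) λ')) (λ β → φ (qtPart μ · β)))))

  expAt-unitExp-shift : ∀ i λ' α x → fromℕQ (nth α i) * (ind (expEq (decAt i α) λ') * x) ≡ fromℕQ (suc (nth λ' i)) * (ind (expEq α (addExp (unitExp i) λ')) * x)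
  expAt-unitExp-shift i λ' α x with expEq α (addExp (unitExp i) λ') in e1
  ... | true = trans (cong₂ (λ u v → fromℕQ u * (ind v * x)) nαi (Equivalence.to T-≡ (⇒expEq (decAt i α) λ' dec))) refl
    where
    E = expEq⇒ α (addExp (unitExp i) λ') (subst T (sym e1) tt)
    nαi : nth α i ≡ suc (nth λ' i)
    nαi = trans (E i) (trans (nth-addExp (unitExp i) λ' i) (cong (ℕ._+ nth λ' i) (nth-unitExp-same i)))
    dec : ∀ t → nth (decAt i α) t ≡ nth λ' t
    dec t with t ℕ.≟ i
    ... | yes refl = trans (nth-decAt-same i α) (cong ℕ.pred nαi)
    ... | no ne = trans (nth-decAt-diff i t α ne) (trans (E t) (trans (nth-addExp (unitExp i) λ' t) (cong (ℕ._+ nth λ' t) (nth-unitExp-diff i t ne))))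
  ... | false with nth α i in e2
  ...   | zero = trans (QP.*-zeroˡ (ind (expEq (decAt i α) λ') * x)) (sym (trans (cong (fromℕQ (suc (nth λ' i)) *_) (QP.*-zeroˡ x)) (QP.*-zeroʳ (fromℕQ (suc (nth λ' i))))))
  ...   | suc y with expEq (decAt i α) λ' in e3
  ...     | false = trans (cong (fromℕQ (suc y) *_) (QP.*-zeroˡ x)) (trans (QP.*-zeroʳ (fromℕQ (suc y))) (sym (trans (cong (fromℕQ (suc (nth λ' i)) *_) (QP.*-zeroˡ x)) (QP.*-zeroʳ (fromℕQ (suc (nth λ' i)))))))
  ...     | true = ⊥-elim (absurd (subst T e1 (⇒expEq α (addExp (unitExp i) λ') back)))
    where
    absurd : T false → ⊥
    absurd ()
    E3 = expEq⇒ (decAt i α) λ' (subst T (sym e3) tt)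
    back : ∀ t → nth α t ≡ nth (addExp (unitExp i) λ') t
    back t with t ℕ.≟ i
    ... | yes refl = trans e2 (trans (cong suc (trans (sym (cong ℕ.pred e2)) (trans (sym (nth-decAt-same t α)) (E3 t))))
                         (sym (trans (nth-addExp (unitExp t) λ' t) (cong (ℕ._+ nth λ' t) (nth-unitExp-same t)))))
    ... | no ne = trans (sym (nth-decAt-diff i t α ne)) (trans (E3 t) (sym (trans (nth-addExp (unitExp i) λ' t) (cong (ℕ._+ nth λ' t) (nth-unitExp-diff i t ne)))))

  ∫At-p⊥ : ∀ i F λ' φ → ∫At (p⊥ i F) λ' φ ≡ fromℕQ (suc i) * fromℕQ (suc (nth λ' i)) * ∫At F (addExp (unitExp i) λ') φ
  ∫At-p⊥ i F λ' φ = trans (∫-p⊥ i F _) (trans (cong (fromℕQ (suc i) *_) (trans (∫-ext F (λ μ → expAt-unitExp-shift i λ' (pe μ) (φ (qtPart μ))))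
     (∫-* F (fromℕQ (suc (nth λ' i))) (λ μ → ind (expEq (pe μ) (addExp (unitExp i) λ')) * φ (qtPart μ))))) (sym (QP.*-assoc (fromℕQ (suc i)) (fromℕQ (suc (nth λ' i))) (∫At F (addExp (unitExp i) λ') φ))))

  oneQT : QT
  oneQT = (1ℚ , 0 , 0) ∷ []

  oneQT-nonZero : NonZeroQT oneQT
  oneQT-nonZero e with cong ℚ.numerator (e (mono 0 0 []))
  ... | ()

  pMonomialΛ : List ℕ → Λ
  pMonomialΛ λ' = ((1ℚ , mono 0 0 λ') ∷ []) /Λ oneQT

  ∫-hall-single : ∀ X c' β dd ψ → WellDefined ψ → ∫ (emb (hallP X ((c' , mono 0 0 β) ∷ []) *QT (dd *QT oneQT))) ψ ≡ (c' * zee β) * ∫At (X *P emb dd) β ψ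
  ∫-hall-single X c' β dd ψ r = begin
      ∫ (emb (hallP X G *QT (dd *QT oneQT))) ψ
    ≡⟨ ∫-emb-*QT (hallP X G) (dd *QT oneQT) ψ ⟩
      ∫ (emb (hallP X G)) (λ x → ∫ (emb (dd *QT oneQT)) (λ y → ψ (x · y)))
    ≡⟨ ∫-ext (emb (hallP X G)) (λ x → trans (∫-emb-*QT dd oneQT _) (∫-ext (emb dd) (λ y →
          trans (QP.+-identityʳ _) (trans (QP.*-identityˡ _) (resp≃ r (≃congʳ x (≃comm y (mono 0 0 [])))))))) ⟩
      ∫ (emb (hallP X G)) φd
    ≡⟨ ∫-hallP-single X c' 0 0 β φd ⟩
      ∫ X (λ μ → ind (expEq (pe μ) β) * (c' * zee β) * φd (mono (qe μ ℕ.+ 0) (te μ ℕ.+ 0) []))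
    ≡⟨ ∫-ext X (λ μ → trans (cong (λ z → ind (expEq (pe μ) β) * (c' * zee β) * z) (cong₂ (λ u v → φd (mono u v [])) (NP.+-identityʳ (qe μ)) (NP.+-identityʳ (te μ))))
          (solve 3 (λ a k f → a :* k :* f := k :* (a :* f)) refl (ind (expEq (pe μ) β)) (c' * zee β) (φd (qtPart μ)))) ⟩
      ∫ X (λ μ → (c' * zee β) * (ind (expEq (pe μ) β) * φd (qtPart μ)))
    ≡⟨ ∫-* X (c' * zee β) _ ⟩
      (c' * zee β) * ∫At X β φd
    ≡⟨ cong ((c' * zee β) *_) (sym (∫At-*emb X dd β ψ)) ⟩
      (c' * zee β) * ∫At (X *P emb dd) β ψ ∎
    where
    open ≡-Reasoning
    G = (c' , mono 0 0 β) ∷ []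
    φd : Mono → ℚ
    φd x = ∫ (emb dd) (λ y → ψ (x · y))

  zee-cancelˡ : ∀ λ' {x y} → zee λ' * x ≡ zee λ' * y → x ≡ y
  zee-cancelˡ λ' {x} {y} e with zee-positive λ'
  ... | N , z≡ = fromℕQ-suc-cancelˡ N (subst (λ z → z * x ≡ z * y) z≡ e)

  -- Pairing with the power-sum monomial p_λ extracts the coefficient of p_λ, weighted by z_λ.
  adjoint-∫At : ∀ i (P : Λ → Λ) →
    ((g h : Λ) → NonZeroQT (den g) → NonZeroQT (den h) → hall (P g) h ≈K hall g (pMul (suc i) h)) →
    ∀ F d → NonZeroQT d → ∀ λ' ψ → WellDefined ψ →
    zee λ' * ∫At (num (P (F /Λ d)) *P emb d) λ' ψ ≡
    zee (addExp (unitExp i) λ') * ∫At (F *P emb (den (P (F /Λ d)))) (addExp (unitExp i) λ') ψ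
  adjoint-∫At i P adj F d nz λ' ψ r = begin
      zee λ' * ∫At (Q *P emb d) λ' ψ
    ≡⟨ cong (_* ∫At (Q *P emb d) λ' ψ) (sym (QP.*-identityˡ (zee λ'))) ⟩
      (1ℚ * zee λ') * ∫At (Q *P emb d) λ' ψ
    ≡⟨ sym (∫-hall-single Q 1ℚ λ' d ψ r) ⟩
      ∫ (emb (hallP Q ((1ℚ , mono 0 0 λ') ∷ []) *QT (d *QT oneQT))) ψ
    ≡⟨ ≈P⇒≈ {emb (hallP Q ((1ℚ , mono 0 0 λ') ∷ []) *QT (d *QT oneQT))} {emb (hallP F ((1ℚ * 1ℚ , mono 0 0 λ'') ∷ []) *QT (e *QT oneQT))}
         (adj (F /Λ d) (pMonomialΛ λ') nz oneQT-nonZero) ψ r ⟩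
      ∫ (emb (hallP F ((1ℚ * 1ℚ , mono 0 0 λ'') ∷ []) *QT (e *QT oneQT))) ψ
    ≡⟨ ∫-hall-single F (1ℚ * 1ℚ) λ'' e ψ r ⟩
      (1ℚ * 1ℚ * zee λ'') * ∫At (F *P emb e) λ'' ψ
    ≡⟨ cong (_* ∫At (F *P emb e) λ'' ψ) (solve 1 (λ z → con 1ℚ :* con 1ℚ :* z := z) refl (zee λ'')) ⟩
      zee λ'' * ∫At (F *P emb e) λ'' ψ ∎
    where
    open ≡-Reasoning
    Q = num (P (F /Λ d))
    e = den (P (F /Λ d))
    λ'' = addExp (unitExp i) λ'

  adjoint-pMul⇒p⊥ : ∀ i (P : Λ → Λ) →
    ((g h : Λ) → NonZeroQT (den g) → NonZeroQT (den h) → hall (P g) h ≈K hall g (pMul (suc i) h)) →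
    ∀ g → NonZeroQT (den g) → (num (P g) *P emb (den g)) ≈ (p⊥ i (num g) *P emb (den (P g)))
  adjoint-pMul⇒p⊥ i P adj (F /Λ d) nz = coef⇒≈ (Q *P emb d) (p⊥ i F *P emb e) (λ n → coef-eq (qe n) (te n) (pe n))
    where
    Q = num (P (F /Λ d))
    e = den (P (F /Λ d))
    coef-eq : ∀ a0 b0 λ' → coef (Q *P emb d) (mono a0 b0 λ') ≡ coef (p⊥ i F *P emb e) (mono a0 b0 λ')
    coef-eq a0 b0 λ' = begin
        coef (Q *P emb d) (mono a0 b0 λ')
      ≡⟨ coef-∫At (Q *P emb d) a0 b0 λ' ⟩
        ∫At (Q *P emb d) λ' ψ
      ≡⟨ zee-cancelˡ λ' (begin
            zee λ' * ∫At (Q *P emb d) λ' ψ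
          ≡⟨ adjoint-∫At i P adj F d nz λ' ψ (χ-wellDefined (mono a0 b0 [])) ⟩
            zee λ'' * B
          ≡⟨ cong (_* B) (zee-unitExp i λ') ⟩
            zee λ' * j * s * B
          ≡⟨ solve 4 (λ z j s b → z :* j :* s :* b := z :* (j :* s :* b)) refl (zee λ') j s B ⟩
            zee λ' * (j * s * B) ∎) ⟩
        j * s * B
      ≡⟨ cong (j * s *_) (∫At-*emb F e λ'' ψ) ⟩
        j * s * ∫At F λ'' (λ m → ∫ (emb e) (λ β → ψ (m · β)))
      ≡⟨ sym (trans (∫At-*emb (p⊥ i F) e λ' ψ) (∫At-p⊥ i F λ' (λ m → ∫ (emb e) (λ β → ψ (m · β))))) ⟩
        ∫At (p⊥ i F *P emb e) λ' ψ
      ≡⟨ sym (coef-∫At (p⊥ i F *P emb e) a0 b0 λ') ⟩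
        coef (p⊥ i F *P emb e) (mono a0 b0 λ') ∎
      where
      open ≡-Reasoning
      ψ = χ (mono a0 b0 [])
      λ'' = addExp (unitExp i) λ'
      j = fromℕQ (suc i)
      s = fromℕQ (suc (nth λ' i))
      B = ∫At (F *P emb e) λ'' ψ


module LoweringOperator where

  open import Data.Nat as ℕ using (ℕ; suc; _≤_; s≤s)
  open import Data.Integer as ℤ using (ℤ)
  open import Data.Rational using (0ℚ; _+_; _*_; -_)
  import Data.Rational.Properties as QP
  open import Data.List using ([]; _++_)
  open import Data.Product using (_×_; _,_)
  open import Relation.Binary.PropositionalEquality
  open import Algebra.Solver.Ring.AlmostCommutativeRing using (_-Raw-AlmostCommutative⟶_)
  open import Defs
  open FormalSum
  open Monomials
  open PolynomialRing
  open NatCast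
  open Transpose
  open DpolyCongruence using (Dpoly-cong; Dpoly-*emb)
  open LoweringIdentity using (p⊥; p⊥-Dpoly)
  open Adjoint using (adjoint-pMul⇒p⊥)
  open PolySolver using (solve; _:+_; _:*_; :-_; _:=_)

  scaleP≋constP* : ∀ s X → scaleP s X ≋ (constP s *P X)
  scaleP≋constP* s X = ≋i (λ ψ r → trans (∫-scaleP s X ψ) (sym (trans (∫-*P (constP s) X ψ) (trans (QP.+-identityʳ _) refl))))

  constP-signQ² : ∀ n → (constP (signQ n) *P constP (signQ n)) ≋ 1P
  constP-signQ² n = ≋trans (≋sym (_-Raw-AlmostCommutative⟶_.*-homo constP-hom (signQ n) (signQ n))) (≋i (λ ψ r → cong (λ z → z * ψ (mono 0 0 []) + 0ℚ) (signQ² n)))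

  D-lower : (k : ℤ) (i : ℕ) (P : Λ → Λ) →
    ((g h : Λ) → NonZeroQT (den g) → NonZeroQT (den h) → hall (P g) h ≈K hall g (pMul (suc i) h)) →
    (f : Λ) → NonZeroQT (den f) →
    D (k ℤ.- ℤ.+ suc i) f ≈Λ scaleΛ (signQ (suc i)) (P (D k f) -Λ D k (P f))
  D-lower k i P adj (F /Λ d) nz =
    ≈⇒≈P {X *P emb (e₁ *QT e₂)} {scaleP s ((Q₁ *P E₂) ++ (negP DQ₂ *P E₁)) *P Ed} (un≋ (≋sym (begin
        scaleP s ((Q₁ *P E₂) ++ (negP DQ₂ *P E₁)) *P Ed
      ≈⟨ ≋* (scaleP≋constP* s ((Q₁ *P E₂) ++ (negP DQ₂ *P E₁))) (≋refl {Ed}) ⟩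
        (σ *P ((Q₁ *P E₂) ++ (negP DQ₂ *P E₁))) *P Ed
      ≈⟨ solve 6 (λ σ Q₁ E₂ DQ₂ E₁ Ed → (σ :* ((Q₁ :* E₂) :+ ((:- DQ₂) :* E₁))) :* Ed := σ :* (((Q₁ :* Ed) :* E₂) :+ (:- (DQ₂ :* Ed)) :* E₁)) ≋refl σ Q₁ E₂ DQ₂ E₁ Ed ⟩
        σ *P (((Q₁ *P Ed) *P E₂) ++ (negP (DQ₂ *P Ed) *P E₁))
      ≈⟨ ≋* (≋refl {σ}) (≋+ (≋* (≋trans P-DF (≋* p⊥-DF (≋refl {E₁}))) (≋refl {E₂})) (≋* (≋neg D-PF) (≋refl {E₁}))) ⟩
        σ *P (((((σ *P X) ++ Dp⊥F) *P E₁) *P E₂) ++ (negP (Dp⊥F *P E₂) *P E₁))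
      ≈⟨ solve 5 (λ σ X D E₁ E₂ → σ :* ((((σ :* X) :+ D) :* E₁) :* E₂ :+ (:- (D :* E₂)) :* E₁) := (σ :* σ) :* (X :* (E₁ :* E₂))) ≋refl σ X Dp⊥F E₁ E₂ ⟩
        (σ *P σ) *P (X *P (E₁ *P E₂))
      ≈⟨ ≋trans (≋* (constP-signQ² (suc i)) (≋refl {X *P (E₁ *P E₂)})) (≋i (*-idˡ (X *P (E₁ *P E₂)))) ⟩
        X *P (E₁ *P E₂)
      ≈⟨ ≋* (≋refl {X}) (≋sym (emb-*QT e₁ e₂)) ⟩
        X *P emb (e₁ *QT e₂) ∎)))
    where
    open ≋-Reasoning
    s = signQ (suc i)
    σ = constP s
    X = Dpoly (k ℤ.- ℤ.+ suc i) F
    Dp⊥F = Dpoly k (p⊥ i F)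
    Q₁ = num (P (Dpoly k F /Λ d))
    e₁ = den (P (Dpoly k F /Λ d))
    Q₂ = num (P (F /Λ d))
    e₂ = den (P (F /Λ d))
    DQ₂ = Dpoly k Q₂
    E₁ = emb e₁
    E₂ = emb e₂
    Ed = emb d
    P-DF : (Q₁ *P Ed) ≋ (p⊥ i (Dpoly k F) *P E₁)
    P-DF = ≋i (adjoint-pMul⇒p⊥ i P adj (Dpoly k F /Λ d) nz)
    p⊥-DF : p⊥ i (Dpoly k F) ≋ ((σ *P X) ++ Dp⊥F)
    p⊥-DF = ≋trans (≋i (p⊥-Dpoly k i F)) (≋+ (scaleP≋constP* s X) (≋refl {Dp⊥F}))
    D-PF : (DQ₂ *P Ed) ≋ (Dp⊥F *P E₂)
    D-PF = ≋trans (≋sym (≋i {Dpoly k (Q₂ *P Ed)} {DQ₂ *P Ed} (Dpoly-*emb k Q₂ d)))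
             (≋trans (≋i (Dpoly-cong k {Q₂ *P Ed} {p⊥ i F *P E₂} (adjoint-pMul⇒p⊥ i P adj (F /Λ d) nz)))
                     (≋i {Dpoly k (p⊥ i F *P E₂)} {Dp⊥F *P E₂} (Dpoly-*emb k (p⊥ i F) e₂)))


open import Data.Nat using (ℕ; suc; _≤_; s≤s)
open import Data.Integer using (ℤ; +_; _+_; _-_)
open import Data.Product using (_×_; _,_)
open RaisingOperator using (D-raise)
open LoweringOperator using (D-lower)

-- ≈Λ compares fractions by cross-multiplication, so nonzero denominators are needed only to
-- invoke the adjointness of P, never for the identities themselves.
mainTheorem2 : (k : ℤ) (j : ℕ) → 1 ≤ j →
    ((f : Λ) → NonZeroQT (den f) →
    D (k + + j) f ≈Λ (D k (pxMMul j f) -Λ pxMMul j (D k f)))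
    ×
    ((P : Λ → Λ) →
    ((g : Λ) → NonZeroQT (den g) → NonZeroQT (den (P g))) →
    ((g h : Λ) → NonZeroQT (den g) → NonZeroQT (den h) →
    hall (P g) h ≈K hall g (pMul j h)) →
    (f : Λ) → NonZeroQT (den f) →
    D (k - + j) f ≈Λ scaleΛ (signQ j) (P (D k f) -Λ D k (P f)))
mainTheorem2 k (suc i) (s≤s _) = (λ f _ → D-raise k i f) , (λ P _ adj f nz → D-lower k i P adj f nz)
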